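{- The proof system $CBV$ is complete in the sense of Cook: for every interpretation $I$ such that $\mathcal L$ is expressive relative to $I$, every program $(D\mid S)$ and all assertions $p,q$, if $I\models\{p\}S\{q\}$ then $\vdash_I\{p\}S\{q\}$.
   Context: Fix a first-order language $\mathcal L$; expressions are terms, Boolean expressions quantifier-free formulas, assertions formulas of $\mathcal L$; $free(p)$ is the set of free variables of $p$; $p[\bar x:=\bar t]$ is simultaneous substitution. Statements: $S ::= skip \mid \bar{x}:=\bar{t} \mid P(\bar{t}) \mid S;S \mid \mathbf{if}\ B\ \mathbf{then}\ S\ \mathbf{else}\ S\ \mathbf{fi} \mid \mathbf{while}\ B\ \mathbf{do}\ S\ \mathbf{od} \mid \mathbf{begin\ local}\ \bar{x}:=\bar{t};\ S\ \mathbf{end}$ (parallel assignment of expressions to a list of distinct variables; calls with actual parameters; blocks with initialized local variables). A declaration $P(\bar u)::S$ has distinct formal parameters $\bar u$ and body $S$; a program $(D\mid S)$ has a fixed set $D$ of declarations with exactly one for each procedure name occurring in it. $var(D\mid S)$ is the set of variables occurring in the program. $change$: $change(D\mid skip)=\emptyset$; $change(D\mid\bar x:=\bar t)=\{\bar x\}$; $change(D\mid P(\bar t))=change(D)\setminus\{\bar u\}$ if $P(\bar u)::S\in D$, $\emptyset$ otherwise; composition/conditional: union of components; while: that of the body; $change(D\mid\mathbf{begin\ local}\ \bar x:=\bar t;\ S\ \mathbf{end})=change(D\mid S)\setminus\{\bar x\}$; $change(P(\bar u)::S)=change(\emptyset\mid S)$; $change(D)=\bigcup_{d\in D}change(d)$.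 Semantics: for an interpretation $I$, states map variables to the domain; $\sigma(t)$, updates $\sigma[\bar x:=\bar d]$, $[\![p]\!]_I$ the states satisfying $p$. $\mathcal M_I[\![S]\!](\sigma)=\{\tau\}$ if $S$ started in $\sigma$ terminates in $\tau$, else $\emptyset$ (standard input/output semantics; blocks restore old values: $\mathcal M_I[\![\mathbf{begin\ local}\ \bar x:=\bar t;\ S\ \mathbf{end}]\!](\sigma)=\mathcal M_I[\![\bar x:=\bar t;\ S]\!](\sigma)[\bar x:=\sigma(\bar x)]$; a call $P(\bar t)$ with $P(\bar u)::S\in D$ has the meaning of $\mathbf{begin\ local}\ \bar u:=\bar t;\ S\ \mathbf{end}$, i.e. call-by-value by inlining with dynamic scope). $I\models\{p\}S\{q\}$ iff $\mathcal M_I[\![S]\!]([\![p]\!]_I)\subseteq[\![q]\!]_I$. $\mathcal L$ is expressive relative to $I$ if for every assertion $p$ and program $(D\mid S)$ the set $\mathcal M_I[\![S]\!]([\![p]\!]_I)$ equals $[\![\phi]\!]_I$ for some formula $\phi$ of $\mathcal L$. Proof system $CBV$: SKIP $\{p\}skip\{p\}$; PARALLEL ASSIGNMENT $\{p[\bar x:=\bar t]\}\bar x:=\bar t\{p\}$; COMPOSITION; CONDITIONAL (from $\{p\wedge B\}S_1\{q\}$, $\{p\wedge\neg B\}S_2\{q\}$); LOOP (from $\{p\wedge B\}S\{p\}$ infer $\{p\}\mathbf{while}\ B\ \mathbf{do}\ S\ \mathbf{od}\{p\wedge\neg B\}$); RECURSION: from $\Phi\vdash\{p\}S\{q\}$ and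 $\Phi\vdash\{p_i\}S_i\{q_i\}$, $i\in\{1,\dots,n\}$, infer $\{p\}S\{q\}$, where $D=\{P_i(\bar u_i)::S_i\mid i\le n\}$, $\Phi=\{\{p_i\}P_i(\bar u_i)\{q_i\}\mid i\le n\}$, $\{\bar u_i\}\cap free(q_i)=\emptyset$, and $\vdash$ denotes provability from $\Phi$ using the remaining axioms and rules; PROCEDURE CALL: from $\{p\}P(\bar u)\{q\}$ infer $\{p[\bar u:=\bar t]\}P(\bar t)\{q\}$ where $P(\bar u)::S\in D$ and $\{\bar u\}\cap free(q)=\emptyset$; BLOCK: from $\{p\}\bar x:=\bar t;S\{q\}$ infer $\{p\}\mathbf{begin\ local}\ \bar x:=\bar t;\ S\ \mathbf{end}\{q\}$ if $\{\bar x\}\cap free(q)=\emptyset$; SUBSTITUTION: from $\{p\}S\{q\}$ infer $\{p[\bar x:=\bar y]\}S\{q[\bar x:=\bar y]\}$ if $\{\bar x\}\cap var(D\mid S)=\emptyset$ and $\{\bar y\}\cap change(D\mid S)=\emptyset$; INVARIANCE: from $\{r\}S\{q\}$ infer $\{p\wedge r\}S\{p\wedge q\}$ if $free(p)\cap change(D\mid S)=\emptyset$; $\exists$-INTRODUCTION: from $\{p\}S\{q\}$ infer $\{\exists\bar x:p\}S\{q\}$ if $\{\bar x\}\cap(var(D\mid S)\cup free(q))=\emptyset$; CONSEQUENCE: from $p\to p_1$, $\{p_1\}S\{q_1\}$, $q_1\to q$ infer $\{p\}S\{q\}$. $\vdash_I\{p\}S\{q\}$ means derivability in $CBV$ with all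 assertions true in $I$ available as premises of CONSEQUENCE. -}

module Defs where

open import Data.Nat using (ℕ; zero; suc; _≟_)
open import Data.Fin using (Fin; zero; suc; fromℕ; inject₁)
open import Data.Vec using (Vec; []; _∷_; toList; lookup)
import Data.Vec as V
open import Data.List using (List; []; _∷_; _++_; concatMap; filter; map)
open import Data.List.Membership.Propositional using (_∈_)
open import Data.List.Membership.DecPropositional _≟_ using (_∈?_)
open import Data.List.Relation.Unary.Unique.Propositional using (Unique)
open import Data.List.Relation.Unary.All using (All)
open import Data.List.Relation.Binary.Disjoint.Propositional using (Disjoint)
open import Data.Product using (Σ; _×_; _,_; proj₁; proj₂)
open import Data.Sum using (_⊎_)
open import Data.Unit using (⊤)
open import Data.Empty using (⊥)
open import Data.Bool using (Bool; true; false; if_then_else_)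
open import Data.Maybe using (Maybe; just; nothing; maybe)
open import Relation.Nullary using (¬_; does; ¬?)

open import Relation.Binary.PropositionalEquality using (_≡_)
open import Function.Bundles using (_⇔_)

-- A first-order language (signature); equality is a logical symbol.

record Signature : Set₁ where
  field
    Fun   : Set
    funAr : Fun → ℕ
    Rel   : Set
    relAr : Rel → ℕ

module Lang (L : Signature) where
  open Signature L

  Var : Set
  Var = ℕ

  -- Locally nameless syntax: free variables are named (fv), bound
  -- variables are de Bruijn indices (bv) scoped by n.
  data Term (n : ℕ) : Set where
    fv  : Var → Term n
    bv  : Fin n → Term n
    app : (f : Fun) → Vec (Term n) (funAr f) → Term n

  Exp : Set
  Exp = Term 0

  data Formula (n : ℕ) : Set where
    tt ff : Formula n
    _≐_   : Term n → Term n → Formula n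
    rel   : (r : Rel) → Vec (Term n) (relAr r) → Formula n
    ¬'_   : Formula n → Formula n
    _∧'_ _∨'_ _⇒'_ : Formula n → Formula n → Formula n
    ∀' ∃' : Formula (suc n) → Formula n

  Assertion : Set
  Assertion = Formula 0

  data QF {n : ℕ} : Formula n → Set where
    tt  : QF tt
    ff  : QF ff
    eq  : ∀ s t → QF (s ≐ t)
    rel : ∀ r ts → QF (rel r ts)
    neg : ∀ {p} → QF p → QF (¬' p)
    and : ∀ {p q} → QF p → QF q → QF (p ∧' q)
    or  : ∀ {p q} → QF p → QF q → QF (p ∨' q)
    imp : ∀ {p q} → QF p → QF q → QF (p ⇒' q)

  record BExp : Set where
    constructor bexp
    field
      form : Assertion
      qf   : QF form

  mutual
    fvT : ∀ {n} → Term n → List Var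
    fvT (fv x) = x ∷ []
    fvT (bv _) = []
    fvT (app f ts) = fvTs ts

    fvTs : ∀ {n k} → Vec (Term n) k → List Var
    fvTs [] = []
    fvTs (t ∷ ts) = fvT t ++ fvTs ts

  free : ∀ {n} → Formula n → List Var
  free tt = []
  free ff = []
  free (s ≐ t) = fvT s ++ fvT t
  free (rel r ts) = fvTs ts
  free (¬' p) = free p
  free (p ∧' q) = free p ++ free q
  free (p ∨' q) = free p ++ free q
  free (p ⇒' q) = free p ++ free q
  free (∀' p) = free p
  free (∃' p) = free p

  -- simultaneous substitution  p[x̄ := t̄]  (capture-free: bound
  -- variables are indices)

  mutual
    wk : ∀ {n} → Exp → Term n
    wk (fv x) = fv x
    wk (bv ())
    wk (app f ts) = app f (wks ts)

    wks : ∀ {n k} → Vec Exp k → Vec (Term n) k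
    wks [] = []
    wks (t ∷ ts) = wk t ∷ wks ts

  look : ∀ {k} → Vec Var k → Vec Exp k → Var → Maybe Exp
  look [] [] y = nothing
  look (x ∷ xs) (t ∷ ts) y = if does (y ≟ x) then just t else look xs ts y

  mutual
    substT : ∀ {n k} → Vec Var k → Vec Exp k → Term n → Term n
    substT xs ts (fv y) = maybe wk (fv y) (look xs ts y)
    substT xs ts (bv i) = bv i
    substT xs ts (app f us) = app f (substTs xs ts us)

    substTs : ∀ {n k m} → Vec Var k → Vec Exp k → Vec (Term n) m → Vec (Term n) m
    substTs xs ts [] = []
    substTs xs ts (u ∷ us) = substT xs ts u ∷ substTs xs ts us

  substF : ∀ {n k} → Vec Var k → Vec Exp k → Formula n → Formula n
  substF xs ts tt = tt
  substF xs ts ff = ff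
  substF xs ts (s ≐ t) = substT xs ts s ≐ substT xs ts t
  substF xs ts (rel r us) = rel r (substTs xs ts us)
  substF xs ts (¬' p) = ¬' substF xs ts p
  substF xs ts (p ∧' q) = substF xs ts p ∧' substF xs ts q
  substF xs ts (p ∨' q) = substF xs ts p ∨' substF xs ts q
  substF xs ts (p ⇒' q) = substF xs ts p ⇒' substF xs ts q
  substF xs ts (∀' p) = ∀' (substF xs ts p)
  substF xs ts (∃' p) = ∃' (substF xs ts p)

  _[_≔_] : ∀ {k} → Assertion → Vec Var k → Vec Exp k → Assertion
  p [ xs ≔ ts ] = substF xs ts p

  mutual
    closeT : ∀ {n} → Var → Term n → Term (suc n)
    closeT x (fv y) = if does (y ≟ x) then bv (fromℕ _) else fv y
    closeT x (bv i) = bv (inject₁ i)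
    closeT x (app f ts) = app f (closeTs x ts)

    closeTs : ∀ {n k} → Var → Vec (Term n) k → Vec (Term (suc n)) k
    closeTs x [] = []
    closeTs x (t ∷ ts) = closeT x t ∷ closeTs x ts

  closeF : ∀ {n} → Var → Formula n → Formula (suc n)
  closeF x tt = tt
  closeF x ff = ff
  closeF x (s ≐ t) = closeT x s ≐ closeT x t
  closeF x (rel r ts) = rel r (closeTs x ts)
  closeF x (¬' p) = ¬' closeF x p
  closeF x (p ∧' q) = closeF x p ∧' closeF x q
  closeF x (p ∨' q) = closeF x p ∨' closeF x q
  closeF x (p ⇒' q) = closeF x p ⇒' closeF x q
  closeF x (∀' p) = ∀' (closeF x p)
  closeF x (∃' p) = ∃' (closeF x p)

  ∃s : List Var → Assertion → Assertion
  ∃s [] p = p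
  ∃s (x ∷ xs) p = ∃' (closeF x (∃s xs p))

  data Stmt : Set where
    skip   : Stmt
    assign : (k : ℕ) (xs : Vec Var k) → Unique (toList xs) → Vec Exp k → Stmt
    call   : (P : ℕ) (k : ℕ) → Vec Exp k → Stmt
    _⨟_    : Stmt → Stmt → Stmt
    ifte   : BExp → Stmt → Stmt → Stmt
    while  : BExp → Stmt → Stmt
    block  : (k : ℕ) (xs : Vec Var k) → Unique (toList xs) → Vec Exp k → Stmt → Stmt

  record Decl : Set where
    constructor decl
    field
      name     : ℕ
      arity    : ℕ
      params   : Vec Var arity
      distinct : Unique (toList params)
      body     : Stmt
  open Decl public

  varS : Stmt → List Var
  varS skip = []
  varS (assign k xs _ ts) = toList xs ++ fvTs ts
  varS (call P k ts) = fvTs ts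
  varS (S₁ ⨟ S₂) = varS S₁ ++ varS S₂
  varS (ifte B S₁ S₂) = free (BExp.form B) ++ varS S₁ ++ varS S₂
  varS (while B S) = free (BExp.form B) ++ varS S
  varS (block k xs _ ts S) = toList xs ++ fvTs ts ++ varS S

  varP : List Decl → Stmt → List Var
  varP D S = varS S ++ concatMap (λ d → toList (params d) ++ varS (body d)) D

  _∖_ : List Var → List Var → List Var
  A ∖ B = filter (λ x → ¬? (x ∈? B)) A

  findDecl : List Decl → ℕ → Maybe Decl
  findDecl [] P = nothing
  findDecl (d ∷ D) P = if does (name d ≟ P) then just d else findDecl D P

  chg : (ℕ → List Var) → Stmt → List Var
  chg c skip = []
  chg c (assign k xs _ ts) = toList xs
  chg c (call P k ts) = c P
  chg c (S₁ ⨟ S₂) = chg c S₁ ++ chg c S₂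
  chg c (ifte B S₁ S₂) = chg c S₁ ++ chg c S₂
  chg c (while B S) = chg c S
  chg c (block k xs _ ts S) = chg c S ∖ toList xs

  changeDecl : Decl → List Var
  changeDecl d = chg (λ _ → []) (body d)

  changeD : List Decl → List Var
  changeD D = concatMap changeDecl D

  changeP : List Decl → Stmt → List Var
  changeP D S = chg (λ P → maybe (λ d → changeD D ∖ toList (params d)) [] (findDecl D P)) S

  callsS : Stmt → List (ℕ × ℕ)
  callsS skip = []
  callsS (assign k xs _ ts) = []
  callsS (call P k ts) = (P , k) ∷ []
  callsS (S₁ ⨟ S₂) = callsS S₁ ++ callsS S₂
  callsS (ifte B S₁ S₂) = callsS S₁ ++ callsS S₂
  callsS (while B S) = callsS S
  callsS (block k xs _ ts S) = callsS S

  WFProg : List Decl → Stmt → Set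
  WFProg D S =
    Unique (map name D) ×
    All (λ c → Σ Decl λ d → d ∈ D × name d ≡ proj₁ c × arity d ≡ proj₂ c)
        (callsS S ++ concatMap (λ d → callsS (body d)) D)

  record Interp : Set₁ where
    field
      Carrier : Set
      funI    : (f : Fun) → Vec Carrier (funAr f) → Carrier
      relI    : (r : Rel) → Vec Carrier (relAr r) → Set

  module _ (I : Interp) where
    open Interp I

    State : Set
    State = Var → Carrier

    mutual
      evalT : ∀ {n} → Vec Carrier n → State → Term n → Carrier
      evalT ρ σ (fv x) = σ x
      evalT ρ σ (bv i) = lookup ρ i
      evalT ρ σ (app f ts) = funI f (evalTs ρ σ ts)

      evalTs : ∀ {n k} → Vec Carrier n → State → Vec (Term n) k → Vec Carrier k
      evalTs ρ σ [] = []
      evalTs ρ σ (t ∷ ts) = evalT ρ σ t ∷ evalTs ρ σ ts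

    Sat : ∀ {n} → Vec Carrier n → State → Formula n → Set
    Sat ρ σ tt = ⊤
    Sat ρ σ ff = ⊥
    Sat ρ σ (s ≐ t) = evalT ρ σ s ≡ evalT ρ σ t
    Sat ρ σ (rel r ts) = relI r (evalTs ρ σ ts)
    Sat ρ σ (¬' p) = ¬ Sat ρ σ p
    Sat ρ σ (p ∧' q) = Sat ρ σ p × Sat ρ σ q
    Sat ρ σ (p ∨' q) = Sat ρ σ p ⊎ Sat ρ σ q
    Sat ρ σ (p ⇒' q) = Sat ρ σ p → Sat ρ σ q
    Sat ρ σ (∀' p) = (d : Carrier) → Sat (d ∷ ρ) σ p
    Sat ρ σ (∃' p) = Σ Carrier λ d → Sat (d ∷ ρ) σ p

    _⊨_ : State → Assertion → Set
    σ ⊨ p = Sat [] σ p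

    upd : ∀ {k} → State → Vec Var k → Vec Carrier k → State
    upd σ [] [] = σ
    upd σ (x ∷ xs) (d ∷ ds) y = if does (y ≟ x) then d else upd σ xs ds y

    data Exec (D : List Decl) : Stmt → State → State → Set where
      e-skip   : ∀ {σ} → Exec D skip σ σ
      e-assign : ∀ {σ k xs u ts} →
                 Exec D (assign k xs u ts) σ (upd σ xs (evalTs [] σ ts))
      e-seq    : ∀ {σ σ' τ S₁ S₂} → Exec D S₁ σ σ' → Exec D S₂ σ' τ →
                 Exec D (S₁ ⨟ S₂) σ τ
      e-if-t   : ∀ {σ τ B S₁ S₂} → σ ⊨ BExp.form B → Exec D S₁ σ τ →
                 Exec D (ifte B S₁ S₂) σ τ
      e-if-f   : ∀ {σ τ B S₁ S₂} → ¬ (σ ⊨ BExp.form B) → Exec D S₂ σ τ →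
                 Exec D (ifte B S₁ S₂) σ τ
      e-wh-t   : ∀ {σ σ' τ B S} → σ ⊨ BExp.form B → Exec D S σ σ' →
                 Exec D (while B S) σ' τ → Exec D (while B S) σ τ
      e-wh-f   : ∀ {σ B S} → ¬ (σ ⊨ BExp.form B) → Exec D (while B S) σ σ
      e-block  : ∀ {σ τ k xs u ts S} → Exec D (assign k xs u ts ⨟ S) σ τ →
                 Exec D (block k xs u ts S) σ (upd τ xs (V.map σ xs))
      e-call   : ∀ {σ τ P k us u S ts} → decl P k us u S ∈ D →
                 Exec D (block k us u ts S) σ τ → Exec D (call P k ts) σ τ

    Valid : List Decl → Assertion → Stmt → Assertion → Set
    Valid D p S q = ∀ σ τ → σ ⊨ p → Exec D S σ τ → τ ⊨ q

    Expressive : Set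
    Expressive = ∀ (p : Assertion) (D : List Decl) (S : Stmt) → WFProg D S →
      Σ Assertion λ φ → ∀ σ → (σ ⊨ φ) ⇔ (Σ State λ τ → (τ ⊨ p) × Exec D S τ σ)

  record Triple : Set where
    constructor ⟪_⟫_⟪_⟫
    field
      pre  : Assertion
      stmt : Stmt
      post : Assertion

  callOf : Decl → Stmt
  callOf d = call (name d) (arity d) (V.map fv (params d))

  specs : List Decl → (Decl → Assertion) → (Decl → Assertion) → List Triple
  specs D pr po = map (λ d → ⟪ pr d ⟫ callOf d ⟪ po d ⟫) D

  -- Pf I D b Φ t : t is derivable from the assumptions Φ, using
  -- assertions true in I in CONSEQUENCE; the RECURSION rule may only be
  -- used when b = true (its premises are derived with b = false, i.e.
  -- "using the remaining axioms and rules").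
  data Pf (I : Interp) (D : List Decl) : Bool → List Triple → Triple → Set where
    hyp         : ∀ {b Φ t} → t ∈ Φ → Pf I D b Φ t
    skip-ax     : ∀ {b Φ p} → Pf I D b Φ ⟪ p ⟫ skip ⟪ p ⟫
    assign-ax   : ∀ {b Φ p k xs u ts} →
                  Pf I D b Φ ⟪ p [ xs ≔ ts ] ⟫ assign k xs u ts ⟪ p ⟫
    composition : ∀ {b Φ p r q S₁ S₂} →
                  Pf I D b Φ ⟪ p ⟫ S₁ ⟪ r ⟫ → Pf I D b Φ ⟪ r ⟫ S₂ ⟪ q ⟫ →
                  Pf I D b Φ ⟪ p ⟫ S₁ ⨟ S₂ ⟪ q ⟫
    conditional : ∀ {b Φ p q B S₁ S₂} →
                  Pf I D b Φ ⟪ p ∧' BExp.form B ⟫ S₁ ⟪ q ⟫ →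
                  Pf I D b Φ ⟪ p ∧' (¬' BExp.form B) ⟫ S₂ ⟪ q ⟫ →
                  Pf I D b Φ ⟪ p ⟫ ifte B S₁ S₂ ⟪ q ⟫
    loop        : ∀ {b Φ p B S} →
                  Pf I D b Φ ⟪ p ∧' BExp.form B ⟫ S ⟪ p ⟫ →
                  Pf I D b Φ ⟪ p ⟫ while B S ⟪ p ∧' (¬' BExp.form B) ⟫
    recursion   : ∀ {Φ p S q} (pr po : Decl → Assertion) →
                  Pf I D false (specs D pr po) ⟪ p ⟫ S ⟪ q ⟫ →
                  (∀ d → d ∈ D → Pf I D false (specs D pr po) ⟪ pr d ⟫ body d ⟪ po d ⟫) →
                  (∀ d → d ∈ D → Disjoint (toList (params d)) (free (po d))) →
                  Pf I D true Φ ⟪ p ⟫ S ⟪ q ⟫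
    proc-call   : ∀ {b Φ p q P k us u S ts} → decl P k us u S ∈ D →
                  Pf I D b Φ ⟪ p ⟫ call P k (V.map fv us) ⟪ q ⟫ →
                  Disjoint (toList us) (free q) →
                  Pf I D b Φ ⟪ p [ us ≔ ts ] ⟫ call P k ts ⟪ q ⟫
    block-rule  : ∀ {b Φ p q k xs u ts S} →
                  Pf I D b Φ ⟪ p ⟫ assign k xs u ts ⨟ S ⟪ q ⟫ →
                  Disjoint (toList xs) (free q) →
                  Pf I D b Φ ⟪ p ⟫ block k xs u ts S ⟪ q ⟫
    substitution : ∀ {b Φ p q S k} (xs ys : Vec Var k) → Unique (toList xs) →
                  Pf I D b Φ ⟪ p ⟫ S ⟪ q ⟫ →
                  Disjoint (toList xs) (varP D S) →
                  Disjoint (toList ys) (changeP D S) →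
                  Pf I D b Φ ⟪ p [ xs ≔ V.map fv ys ] ⟫ S ⟪ q [ xs ≔ V.map fv ys ] ⟫
    invariance  : ∀ {b Φ p r q S} →
                  Pf I D b Φ ⟪ r ⟫ S ⟪ q ⟫ →
                  Disjoint (free p) (changeP D S) →
                  Pf I D b Φ ⟪ p ∧' r ⟫ S ⟪ p ∧' q ⟫
    ∃-intro     : ∀ {b Φ p q S} (xs : List Var) →
                  Pf I D b Φ ⟪ p ⟫ S ⟪ q ⟫ →
                  Disjoint xs (varP D S ++ free q) →
                  Pf I D b Φ ⟪ ∃s xs p ⟫ S ⟪ q ⟫
    consequence : ∀ {b Φ p p₁ q₁ q S} →
                  (∀ σ → _⊨_ I σ (p ⇒' p₁)) →
                  Pf I D b Φ ⟪ p₁ ⟫ S ⟪ q₁ ⟫ →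
                  (∀ σ → _⊨_ I σ (q₁ ⇒' q)) →
                  Pf I D b Φ ⟪ p ⟫ S ⟪ q ⟫

  Provable : Interp → List Decl → Assertion → Stmt → Assertion → Set
  Provable I D p S q = Pf I D true [] ⟪ p ⟫ S ⟪ q ⟫

-- Cook's argument.  All variables of the program lie below a bound N, so the variables from N on
-- are untouched by executions and can serve as fresh copies x̄ ↦ K + x̄ of the program variables x̄.
-- Expressiveness yields strongest postconditions sp, and, by quantifying over a copy of a final
-- state, weakest liberal preconditions; valid triples are then derived by induction on the
-- statement, with sp as the intermediate assertion of a composition and wlp as loop invariant.
-- Each procedure gets the most general specification {x̄ = z̄} P(ū) {∃ū. sp(x̄ = z̄, P(ū))}, with
-- z̄ freezing the initial state.  A call P(t̄) is derived from it by SUBSTITUTION of a copy of the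
-- entry state for z̄, PROCEDURE CALL, INVARIANCE of a copy of the state before the call, and
-- ∃-INTRODUCTION of both copies.
module Submission where

open import Defs
open import Data.Nat using (ℕ; zero; suc; _+_; _≤_; _<_; s≤s)
open import Data.Nat.Properties
  using (_≟_; ≤-<-connex; <⇒≱; ≮⇒≥; ≤-trans; <-≤-trans; m≤m+n; m≤n+m; +-cancelˡ-≡; +-monoʳ-<)
open import Data.Fin as Fin using (fromℕ; inject₁)
open import Data.Vec using (Vec; []; _∷_; toList; lookup; _∷ʳ_)
import Data.Vec as V
import Data.Vec.Properties as V
open import Data.List using (List; []; _∷_; _++_; concatMap; map; downFrom)
open import Data.List.Properties using (++-assoc)
open import Data.List.Extrema.Nat using (max; xs≤max)
open import Data.List.Membership.Propositional using (_∈_; _∉_; find; lose)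
open import Data.List.Membership.Propositional.Properties
  using (∈-map⁺; ∈-map⁻; ∈-++⁺ˡ; ∈-++⁺ʳ; ∈-++⁻; ∈-downFrom⁺; ∈-downFrom⁻)
open import Data.List.Membership.DecPropositional _≟_ using (_∈?_)
open import Data.List.Relation.Unary.Any using (here; there; any?)
open import Data.List.Relation.Unary.All using (All; []; _∷_)
import Data.List.Relation.Unary.All as All
import Data.List.Relation.Unary.All.Properties as All
open import Data.List.Relation.Unary.Unique.Propositional using (Unique)
import Data.List.Relation.Unary.AllPairs as AP
import Data.List.Relation.Unary.Unique.Propositional.Properties as Unique
open import Data.List.Relation.Binary.Disjoint.Propositional using (Disjoint)
import Data.List.Relation.Binary.Disjoint.Propositional.Properties as Disjoint
open import Data.Product using (Σ; ∃; _×_; _,_; proj₁; proj₂)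
open import Data.Product.Function.NonDependent.Propositional using (_×-⇔_)
open import Data.Sum.Function.Propositional using (_⊎-⇔_)
open import Data.Empty using (⊥-elim)
open import Data.Sum using (_⊎_; inj₁; inj₂; [_,_]′; swap)
open import Data.Bool using (true; false)
open import Data.Maybe using (just; nothing; maybe)
open import Relation.Nullary using (Dec; does; proof; yes; no; ofʸ; ofⁿ; ¬?; _×-dec_)
import Relation.Nullary.Decidable as Dec
open import Relation.Binary.PropositionalEquality
open ≡-Reasoning
open import Function using (_∘_; id)
open import Function.Bundles using (_⇔_; mk⇔; Equivalence)
open import Function.Related.TypeIsomorphisms using (→-cong-⇔; ¬-cong-⇔)
import Function.Properties.Equivalence as ⇔

open Equivalence using (to; from)

private
  variable
    A B : Set

∀-cong-⇔ : {P Q : A → Set} → (∀ a → P a ⇔ Q a) → (∀ a → P a) ⇔ (∀ a → Q a)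
∀-cong-⇔ P⇔Q = mk⇔ (λ f a → to (P⇔Q a) (f a)) (λ f a → from (P⇔Q a) (f a))

∃-cong-⇔ : {P Q : A → Set} → (∀ a → P a ⇔ Q a) → Σ A P ⇔ Σ A Q
∃-cong-⇔ P⇔Q = mk⇔ (λ (a , p) → a , to (P⇔Q a) p) (λ (a , q) → a , from (P⇔Q a) q)

≡-cong-⇔ : {a a′ b b′ : A} → a ≡ a′ → b ≡ b′ → (a ≡ b) ⇔ (a′ ≡ b′)
≡-cong-⇔ refl refl = ⇔.refl

subst-⇔ : (P : A → Set) {a b : A} → a ≡ b → P a ⇔ P b
subst-⇔ P refl = ⇔.refl

lookup-∷ʳ-fromℕ : ∀ {n} (ρ : Vec A n) a → lookup (ρ ∷ʳ a) (fromℕ n) ≡ a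
lookup-∷ʳ-fromℕ []      a = refl
lookup-∷ʳ-fromℕ (_ ∷ ρ) a = lookup-∷ʳ-fromℕ ρ a

lookup-∷ʳ-inject₁ : ∀ {n} (ρ : Vec A n) a i → lookup (ρ ∷ʳ a) (inject₁ i) ≡ lookup ρ i
lookup-∷ʳ-inject₁ (_ ∷ ρ) a Fin.zero    = refl
lookup-∷ʳ-inject₁ (_ ∷ ρ) a (Fin.suc i) = lookup-∷ʳ-inject₁ ρ a i

∈-toList-map⁻ : ∀ {n} (f : A → B) {xs : Vec A n} {y} → y ∈ toList (V.map f xs) →
                ∃ λ x → x ∈ toList xs × y ≡ f x
∈-toList-map⁻ f {xs} y∈ = ∈-map⁻ f (subst (_ ∈_) (V.toList-map f xs) y∈)

map-cong-∈ : ∀ {n} {f g : A → B} (xs : Vec A n) → (∀ {x} → x ∈ toList xs → f x ≡ g x) →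
             V.map f xs ≡ V.map g xs
map-cong-∈ []       f≡g = refl
map-cong-∈ (x ∷ xs) f≡g = cong₂ _∷_ (f≡g (here refl)) (map-cong-∈ xs (λ x∈ → f≡g (there x∈)))

allBelow : (n : ℕ) → Vec ℕ n
allBelow zero    = []
allBelow (suc n) = n ∷ allBelow n

toList-allBelow : ∀ n → toList (allBelow n) ≡ downFrom n
toList-allBelow zero    = refl
toList-allBelow (suc n) = cong (n ∷_) (toList-allBelow n)

∈-allBelow⁺ : ∀ {n i} → i < n → i ∈ toList (allBelow n)
∈-allBelow⁺ {n} i<n = subst (_ ∈_) (sym (toList-allBelow n)) (∈-downFrom⁺ i<n)

∈-allBelow⁻ : ∀ {n i} → i ∈ toList (allBelow n) → i < n
∈-allBelow⁻ {n} i∈ = ∈-downFrom⁻ (subst (_ ∈_) (toList-allBelow n) i∈)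

fresh : List ℕ → ℕ
fresh xs = suc (max 0 xs)

<-fresh : ∀ xs → All (_< fresh xs) xs
<-fresh xs = All.map s≤s (xs≤max 0 xs)

∉-above : ∀ {K y} {xs : List ℕ} → All (_< K) xs → K ≤ y → y ∉ xs
∉-above xs<K K≤y y∈ = <⇒≱ (All.lookup xs<K y∈) K≤y

All∉⇒Disjoint : {xs ys : List A} → All (_∉ xs) ys → Disjoint xs ys
All∉⇒Disjoint ys∉xs (v∈xs , v∈ys) = All.lookup ys∉xs v∈ys v∈xs

separated⇒Disjoint : ∀ K {xs ys : List ℕ} → All (K ≤_) xs → All (_< K) ys → Disjoint xs ys
separated⇒Disjoint K K≤xs ys<K (v∈xs , v∈ys) = <⇒≱ (All.lookup ys<K v∈ys) (All.lookup K≤xs v∈xs)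

-- Free and changed variables

module Syntax (L : Signature) where
  open Lang L

  ∀s : List Var → Assertion → Assertion
  ∀s []       p = p
  ∀s (x ∷ xs) p = ∀' (closeF x (∀s xs p))

  DeclsBelow : ℕ → List Decl → Set
  DeclsBelow N D = ∀ {d} → d ∈ D → All (_< N) (toList (params d) ++ varS (body d))

  equate : List Var → (Var → Var) → Assertion
  equate []       g = tt
  equate (x ∷ xs) g = (fv x ≐ fv (g x)) ∧' equate xs g

  mutual
    fvT-wk : ∀ {n} (t : Exp) → fvT {n} (wk t) ≡ fvT t
    fvT-wk (fv x)     = refl
    fvT-wk (app f ts) = fvTs-wks ts

    fvTs-wks : ∀ {n k} (ts : Vec Exp k) → fvTs {n} (wks ts) ≡ fvTs ts
    fvTs-wks []       = refl
    fvTs-wks (t ∷ ts) = cong₂ _++_ (fvT-wk t) (fvTs-wks ts)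

  fvTs-map-fv : ∀ {n k} (xs : Vec Var k) → fvTs {n} (V.map fv xs) ≡ toList xs
  fvTs-map-fv []       = refl
  fvTs-map-fv (x ∷ xs) = cong (x ∷_) (fvTs-map-fv xs)

  fvT-look : ∀ {Q : Var → Set} {n k} (xs : Vec Var k) (ts : Vec Exp k) y → All Q (fvTs ts) →
             (y ∉ toList xs → Q y) → All Q (fvT {n} (maybe wk (fv y) (look xs ts y)))
  fvT-look []       []       y _   Qy = Qy (λ ()) ∷ []
  fvT-look (x ∷ xs) (t ∷ ts) y Qts Qy with does (y ≟ x) | proof (y ≟ x)
  ... | true  | _       = subst (All _) (sym (fvT-wk t)) (All.++⁻ˡ (fvT t) Qts)
  ... | false | ofⁿ y≢x = fvT-look xs ts y (All.++⁻ʳ (fvT t) Qts)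
                            (λ y∉xs → Qy λ { (here y≡x) → y≢x y≡x ; (there y∈xs) → y∉xs y∈xs })

  module _ {Q : Var → Set} {k} (xs : Vec Var k) (ts : Vec Exp k) (Qts : All Q (fvTs ts)) where
    mutual
      fvT-substT : ∀ {n} (t : Term n) → (∀ {y} → y ∈ fvT t → y ∉ toList xs → Q y) →
                   All Q (fvT (substT xs ts t))
      fvT-substT (fv y)     h = fvT-look xs ts y Qts (h (here refl))
      fvT-substT (bv i)     h = []
      fvT-substT (app f us) h = fvTs-substTs us h

      fvTs-substTs : ∀ {n m} (us : Vec (Term n) m) → (∀ {y} → y ∈ fvTs us → y ∉ toList xs → Q y) →
                     All Q (fvTs (substTs xs ts us))
      fvTs-substTs []       h = []
      fvTs-substTs (u ∷ us) h =
        All.++⁺ (fvT-substT u (λ y∈ → h (∈-++⁺ˡ y∈))) (fvTs-substTs us (λ y∈ → h (∈-++⁺ʳ (fvT u) y∈)))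

    free-substF : ∀ {n} (p : Formula n) → (∀ {y} → y ∈ free p → y ∉ toList xs → Q y) →
                  All Q (free (substF xs ts p))
    free-substF tt         h = []
    free-substF ff         h = []
    free-substF (a ≐ b)    h =
      All.++⁺ (fvT-substT a (λ y∈ → h (∈-++⁺ˡ y∈))) (fvT-substT b (λ y∈ → h (∈-++⁺ʳ (fvT a) y∈)))
    free-substF (rel r us) h = fvTs-substTs us h
    free-substF (¬' p)     h = free-substF p h
    free-substF (p ∧' q)   h =
      All.++⁺ (free-substF p (λ y∈ → h (∈-++⁺ˡ y∈))) (free-substF q (λ y∈ → h (∈-++⁺ʳ (free p) y∈)))
    free-substF (p ∨' q)   h =
      All.++⁺ (free-substF p (λ y∈ → h (∈-++⁺ˡ y∈))) (free-substF q (λ y∈ → h (∈-++⁺ʳ (free p) y∈)))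
    free-substF (p ⇒' q)   h =
      All.++⁺ (free-substF p (λ y∈ → h (∈-++⁺ˡ y∈))) (free-substF q (λ y∈ → h (∈-++⁺ʳ (free p) y∈)))
    free-substF (∀' p)     h = free-substF p h
    free-substF (∃' p)     h = free-substF p h

  module _ {Q : Var → Set} (x : Var) where
    mutual
      fvT-closeT : ∀ {n} (t : Term n) → (∀ {y} → y ∈ fvT t → y ≢ x → Q y) → All Q (fvT (closeT x t))
      fvT-closeT (fv y) h with does (y ≟ x) | proof (y ≟ x)
      ... | true  | _       = []
      ... | false | ofⁿ y≢x = h (here refl) y≢x ∷ []
      fvT-closeT (bv i)     h = []
      fvT-closeT (app f ts) h = fvTs-closeTs ts h

      fvTs-closeTs : ∀ {n m} (ts : Vec (Term n) m) → (∀ {y} → y ∈ fvTs ts → y ≢ x → Q y) →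
                     All Q (fvTs (closeTs x ts))
      fvTs-closeTs []       h = []
      fvTs-closeTs (t ∷ ts) h =
        All.++⁺ (fvT-closeT t (λ y∈ → h (∈-++⁺ˡ y∈))) (fvTs-closeTs ts (λ y∈ → h (∈-++⁺ʳ (fvT t) y∈)))

    free-closeF : ∀ {n} (p : Formula n) → (∀ {y} → y ∈ free p → y ≢ x → Q y) → All Q (free (closeF x p))
    free-closeF tt         h = []
    free-closeF ff         h = []
    free-closeF (a ≐ b)    h =
      All.++⁺ (fvT-closeT a (λ y∈ → h (∈-++⁺ˡ y∈))) (fvT-closeT b (λ y∈ → h (∈-++⁺ʳ (fvT a) y∈)))
    free-closeF (rel r ts) h = fvTs-closeTs ts h
    free-closeF (¬' p)     h = free-closeF p h
    free-closeF (p ∧' q)   h =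
      All.++⁺ (free-closeF p (λ y∈ → h (∈-++⁺ˡ y∈))) (free-closeF q (λ y∈ → h (∈-++⁺ʳ (free p) y∈)))
    free-closeF (p ∨' q)   h =
      All.++⁺ (free-closeF p (λ y∈ → h (∈-++⁺ˡ y∈))) (free-closeF q (λ y∈ → h (∈-++⁺ʳ (free p) y∈)))
    free-closeF (p ⇒' q)   h =
      All.++⁺ (free-closeF p (λ y∈ → h (∈-++⁺ˡ y∈))) (free-closeF q (λ y∈ → h (∈-++⁺ʳ (free p) y∈)))
    free-closeF (∀' p)     h = free-closeF p h
    free-closeF (∃' p)     h = free-closeF p h

  free-∃s : ∀ {Q : Var → Set} ws p → (∀ {y} → y ∈ free p → y ∉ ws → Q y) → All Q (free (∃s ws p))
  free-∃s []       p h = All.tabulate (λ y∈ → h y∈ (λ ()))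
  free-∃s {Q} (x ∷ ws) p h = free-closeF x (∃s ws p) (λ y∈ → All.lookup (free-∃s ws p h′) y∈)
    where
    h′ : ∀ {y} → y ∈ free p → y ∉ ws → y ≢ x → Q y
    h′ y∈ y∉ws y≢x = h y∈ λ { (here y≡x) → y≢x y≡x ; (there y∈ws) → y∉ws y∈ws }

  free-equate : ∀ {Q : Var → Set} xs g → All Q xs → All (Q ∘ g) xs → All Q (free (equate xs g))
  free-equate []       g []         []           = []
  free-equate (x ∷ xs) g (Qx ∷ Qxs) (Qgx ∷ Qgxs) = Qx ∷ Qgx ∷ free-equate xs g Qxs Qgxs

  All-chg : ∀ {Q : Var → Set} c S → All Q (varS S) → (∀ P → All Q (c P)) → All Q (chg c S)
  All-chg c skip                _  _  = []
  All-chg c (assign k xs _ ts)  QS _  = All.++⁻ˡ (toList xs) QS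
  All-chg c (call P k ts)       _  Qc = Qc P
  All-chg c (S₁ ⨟ S₂)           QS Qc =
    All.++⁺ (All-chg c S₁ (All.++⁻ˡ (varS S₁) QS) Qc) (All-chg c S₂ (All.++⁻ʳ (varS S₁) QS) Qc)
  All-chg c (ifte B S₁ S₂)      QS Qc =
    All.++⁺ (All-chg c S₁ (All.++⁻ˡ (varS S₁) (All.++⁻ʳ (free (BExp.form B)) QS)) Qc)
            (All-chg c S₂ (All.++⁻ʳ (varS S₁) (All.++⁻ʳ (free (BExp.form B)) QS)) Qc)
  All-chg c (while B S)         QS Qc = All-chg c S (All.++⁻ʳ (free (BExp.form B)) QS) Qc
  All-chg c (block k xs _ ts S) QS Qc =
    All.filter⁺ _ (All-chg c S (All.++⁻ʳ (fvTs ts) (All.++⁻ʳ (toList xs) QS)) Qc)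

-- Semantics of assertions

module Semantics (L : Signature) (I : Lang.Interp L) where
  open Lang L hiding (_⊨_)
  open Syntax L
  open Interp I

  infix 4 _⊨_ _≗_except_
  infixl 8 _[_↦_]

  _⊨_ : State I → Assertion → Set
  σ ⊨ p = Lang._⊨_ L I σ p

  _[_↦_] : ∀ {k} → State I → Vec Var k → Vec Carrier k → State I
  σ [ xs ↦ ds ] = upd I σ xs ds

  ⟦_⟧_ : ∀ {k} → Vec Exp k → State I → Vec Carrier k
  ⟦ ts ⟧ σ = evalTs I [] σ ts

  _≗_except_ : State I → State I → List Var → Set
  σ ≗ τ except ws = ∀ y → y ∉ ws → σ y ≡ τ y

  mutual
    evalT-cong : ∀ {n} (ρ : Vec Carrier n) {σ σ′} (t : Term n) → (∀ {y} → y ∈ fvT t → σ y ≡ σ′ y) →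
                 evalT I ρ σ t ≡ evalT I ρ σ′ t
    evalT-cong ρ (fv x)     h = h (here refl)
    evalT-cong ρ (bv i)     h = refl
    evalT-cong ρ (app f ts) h = cong (funI f) (evalTs-cong ρ ts h)

    evalTs-cong : ∀ {n k} (ρ : Vec Carrier n) {σ σ′} (ts : Vec (Term n) k) →
                  (∀ {y} → y ∈ fvTs ts → σ y ≡ σ′ y) → evalTs I ρ σ ts ≡ evalTs I ρ σ′ ts
    evalTs-cong ρ []       h = refl
    evalTs-cong ρ (t ∷ ts) h =
      cong₂ _∷_ (evalT-cong ρ t (λ y∈ → h (∈-++⁺ˡ y∈))) (evalTs-cong ρ ts (λ y∈ → h (∈-++⁺ʳ (fvT t) y∈)))

  Sat-cong : ∀ {n} (ρ : Vec Carrier n) {σ σ′} (p : Formula n) → (∀ {y} → y ∈ free p → σ y ≡ σ′ y) →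
             Sat I ρ σ p ⇔ Sat I ρ σ′ p
  Sat-cong ρ tt         h = ⇔.refl
  Sat-cong ρ ff         h = ⇔.refl
  Sat-cong ρ (a ≐ b)    h =
    ≡-cong-⇔ (evalT-cong ρ a (λ y∈ → h (∈-++⁺ˡ y∈))) (evalT-cong ρ b (λ y∈ → h (∈-++⁺ʳ (fvT a) y∈)))
  Sat-cong ρ (rel r ts) h = subst-⇔ (relI r) (evalTs-cong ρ ts h)
  Sat-cong ρ (¬' p)     h = ¬-cong-⇔ (Sat-cong ρ p h)
  Sat-cong ρ (p ∧' q)   h =
    Sat-cong ρ p (λ y∈ → h (∈-++⁺ˡ y∈)) ×-⇔ Sat-cong ρ q (λ y∈ → h (∈-++⁺ʳ (free p) y∈))
  Sat-cong ρ (p ∨' q)   h =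
    Sat-cong ρ p (λ y∈ → h (∈-++⁺ˡ y∈)) ⊎-⇔ Sat-cong ρ q (λ y∈ → h (∈-++⁺ʳ (free p) y∈))
  Sat-cong ρ (p ⇒' q)   h =
    →-cong-⇔ (Sat-cong ρ p (λ y∈ → h (∈-++⁺ˡ y∈))) (Sat-cong ρ q (λ y∈ → h (∈-++⁺ʳ (free p) y∈)))
  Sat-cong ρ (∀' p)     h = ∀-cong-⇔ (λ d → Sat-cong (d ∷ ρ) p h)
  Sat-cong ρ (∃' p)     h = ∃-cong-⇔ (λ d → Sat-cong (d ∷ ρ) p h)

  ⊨-cong : ∀ p {σ σ′} → (∀ {y} → y ∈ free p → σ y ≡ σ′ y) → σ ⊨ p → σ′ ⊨ p
  ⊨-cong p h = to (Sat-cong [] p h)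

  ⊨-≗ : ∀ p {σ σ′} → σ ≗ σ′ → σ ⊨ p → σ′ ⊨ p
  ⊨-≗ p σ≗σ′ = ⊨-cong p (λ {y} _ → σ≗σ′ y)

  mutual
    evalT-wk : ∀ {n} (ρ : Vec Carrier n) σ (t : Exp) → evalT I ρ σ (wk t) ≡ evalT I [] σ t
    evalT-wk ρ σ (fv x)     = refl
    evalT-wk ρ σ (app f ts) = cong (funI f) (evalTs-wks ρ σ ts)

    evalTs-wks : ∀ {n k} (ρ : Vec Carrier n) σ (ts : Vec Exp k) → evalTs I ρ σ (wks ts) ≡ ⟦ ts ⟧ σ
    evalTs-wks ρ σ []       = refl
    evalTs-wks ρ σ (t ∷ ts) = cong₂ _∷_ (evalT-wk ρ σ t) (evalTs-wks ρ σ ts)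

  evalT-look : ∀ {n k} (ρ : Vec Carrier n) σ (xs : Vec Var k) (ts : Vec Exp k) y →
               evalT I ρ σ (maybe wk (fv y) (look xs ts y)) ≡ (σ [ xs ↦ ⟦ ts ⟧ σ ]) y
  evalT-look ρ σ []       []       y = refl
  evalT-look ρ σ (x ∷ xs) (t ∷ ts) y with does (y ≟ x)
  ... | true  = evalT-wk ρ σ t
  ... | false = evalT-look ρ σ xs ts y

  module _ {k} (xs : Vec Var k) (ts : Vec Exp k) where
    mutual
      evalT-substT : ∀ {n} (ρ : Vec Carrier n) σ (t : Term n) →
                     evalT I ρ σ (substT xs ts t) ≡ evalT I ρ (σ [ xs ↦ ⟦ ts ⟧ σ ]) t
      evalT-substT ρ σ (fv y)     = evalT-look ρ σ xs ts y
      evalT-substT ρ σ (bv i)     = refl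
      evalT-substT ρ σ (app f us) = cong (funI f) (evalTs-substTs ρ σ us)

      evalTs-substTs : ∀ {n m} (ρ : Vec Carrier n) σ (us : Vec (Term n) m) →
                       evalTs I ρ σ (substTs xs ts us) ≡ evalTs I ρ (σ [ xs ↦ ⟦ ts ⟧ σ ]) us
      evalTs-substTs ρ σ []       = refl
      evalTs-substTs ρ σ (u ∷ us) = cong₂ _∷_ (evalT-substT ρ σ u) (evalTs-substTs ρ σ us)

    Sat-substF : ∀ {n} (ρ : Vec Carrier n) σ (p : Formula n) →
                 Sat I ρ σ (substF xs ts p) ⇔ Sat I ρ (σ [ xs ↦ ⟦ ts ⟧ σ ]) p
    Sat-substF ρ σ tt         = ⇔.refl
    Sat-substF ρ σ ff         = ⇔.refl
    Sat-substF ρ σ (a ≐ b)    = ≡-cong-⇔ (evalT-substT ρ σ a) (evalT-substT ρ σ b)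
    Sat-substF ρ σ (rel r us) = subst-⇔ (relI r) (evalTs-substTs ρ σ us)
    Sat-substF ρ σ (¬' p)     = ¬-cong-⇔ (Sat-substF ρ σ p)
    Sat-substF ρ σ (p ∧' q)   = Sat-substF ρ σ p ×-⇔ Sat-substF ρ σ q
    Sat-substF ρ σ (p ∨' q)   = Sat-substF ρ σ p ⊎-⇔ Sat-substF ρ σ q
    Sat-substF ρ σ (p ⇒' q)   = →-cong-⇔ (Sat-substF ρ σ p) (Sat-substF ρ σ q)
    Sat-substF ρ σ (∀' p)     = ∀-cong-⇔ (λ d → Sat-substF (d ∷ ρ) σ p)
    Sat-substF ρ σ (∃' p)     = ∃-cong-⇔ (λ d → Sat-substF (d ∷ ρ) σ p)

    ⊨-subst : ∀ σ p → σ ⊨ p [ xs ≔ ts ] ⇔ σ [ xs ↦ ⟦ ts ⟧ σ ] ⊨ p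
    ⊨-subst = Sat-substF []

  evalTs-map-fv : ∀ {n k} (ρ : Vec Carrier n) σ (xs : Vec Var k) → evalTs I ρ σ (V.map fv xs) ≡ V.map σ xs
  evalTs-map-fv ρ σ []       = refl
  evalTs-map-fv ρ σ (x ∷ xs) = cong (σ x ∷_) (evalTs-map-fv ρ σ xs)

  ⊨-rename : ∀ {k} (xs ys : Vec Var k) σ p → σ ⊨ p [ xs ≔ V.map fv ys ] ⇔ σ [ xs ↦ V.map σ ys ] ⊨ p
  ⊨-rename xs ys σ p =
    subst (λ ds → σ ⊨ p [ xs ≔ V.map fv ys ] ⇔ σ [ xs ↦ ds ] ⊨ p) (evalTs-map-fv [] σ ys)
          (⊨-subst xs (V.map fv ys) σ p)

  upd-∉ : ∀ {k} σ (xs : Vec Var k) ds {y} → y ∉ toList xs → (σ [ xs ↦ ds ]) y ≡ σ y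
  upd-∉ σ []       []       y∉ = refl
  upd-∉ σ (x ∷ xs) (d ∷ ds) {y} y∉ with does (y ≟ x) | proof (y ≟ x)
  ... | true  | ofʸ y≡x = ⊥-elim (y∉ (here y≡x))
  ... | false | _       = upd-∉ σ xs ds (λ y∈ → y∉ (there y∈))

  upd-cong : ∀ {k} {σ σ′} (xs : Vec Var k) ds {y} → (y ∉ toList xs → σ y ≡ σ′ y) →
             (σ [ xs ↦ ds ]) y ≡ (σ′ [ xs ↦ ds ]) y
  upd-cong []       []       h = h (λ ())
  upd-cong (x ∷ xs) (d ∷ ds) {y} h with does (y ≟ x) | proof (y ≟ x)
  ... | true  | _       = refl
  ... | false | ofⁿ y≢x = upd-cong xs ds (λ y∉ → h λ { (here y≡x) → y≢x y≡x ; (there y∈) → y∉ y∈ })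

  upd-map-∈ : ∀ {k} σ {f : Var → Var} → (∀ {a b} → f a ≡ f b → a ≡ b) → (g : Var → Carrier)
              (xs : Vec Var k) → ∀ {x} → x ∈ toList xs → (σ [ V.map f xs ↦ V.map g xs ]) (f x) ≡ g x
  upd-map-∈ σ {f} f-inj g (x′ ∷ xs) {x} x∈ with does (f x ≟ f x′) | proof (f x ≟ f x′) | x∈
  ... | true  | ofʸ fx≡fx′ | _         = cong g (sym (f-inj fx≡fx′))
  ... | false | ofⁿ fx≢fx′ | here x≡x′ = ⊥-elim (fx≢fx′ (cong f x≡x′))
  ... | false | _          | there x∈′ = upd-map-∈ σ f-inj g xs x∈′

  upd-∈ : ∀ {k} σ (g : Var → Carrier) (xs : Vec Var k) → ∀ {x} → x ∈ toList xs →
          (σ [ xs ↦ V.map g xs ]) x ≡ g x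
  upd-∈ σ g xs {x} x∈ =
    subst (λ zs → (σ [ zs ↦ V.map g xs ]) x ≡ g x) (V.map-id xs) (upd-map-∈ σ id g xs x∈)

  upd-self : ∀ {k} σ (xs : Vec Var k) → σ [ xs ↦ V.map σ xs ] ≗ σ
  upd-self σ xs y with y ∈? toList xs
  ... | yes y∈ = upd-∈ σ σ xs y∈
  ... | no  y∉ = upd-∉ σ xs (V.map σ xs) y∉

  upd-self-fv : ∀ {k} σ (xs : Vec Var k) → σ [ xs ↦ ⟦ V.map fv xs ⟧ σ ] ≗ σ
  upd-self-fv σ xs y = trans (cong (λ ds → (σ [ xs ↦ ds ]) y) (evalTs-map-fv [] σ xs)) (upd-self σ xs y)

  mutual
    evalT-closeT : ∀ {n} (ρ : Vec Carrier n) σ x d (t : Term n) →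
                   evalT I (ρ ∷ʳ d) σ (closeT x t) ≡ evalT I ρ (σ [ x ∷ [] ↦ d ∷ [] ]) t
    evalT-closeT ρ σ x d (fv y) with does (y ≟ x)
    ... | true  = lookup-∷ʳ-fromℕ ρ d
    ... | false = refl
    evalT-closeT ρ σ x d (bv i)     = lookup-∷ʳ-inject₁ ρ d i
    evalT-closeT ρ σ x d (app f ts) = cong (funI f) (evalTs-closeTs ρ σ x d ts)

    evalTs-closeTs : ∀ {n k} (ρ : Vec Carrier n) σ x d (ts : Vec (Term n) k) →
                     evalTs I (ρ ∷ʳ d) σ (closeTs x ts) ≡ evalTs I ρ (σ [ x ∷ [] ↦ d ∷ [] ]) ts
    evalTs-closeTs ρ σ x d []       = refl
    evalTs-closeTs ρ σ x d (t ∷ ts) = cong₂ _∷_ (evalT-closeT ρ σ x d t) (evalTs-closeTs ρ σ x d ts)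

  Sat-closeF : ∀ {n} (ρ : Vec Carrier n) σ x d (p : Formula n) →
               Sat I (ρ ∷ʳ d) σ (closeF x p) ⇔ Sat I ρ (σ [ x ∷ [] ↦ d ∷ [] ]) p
  Sat-closeF ρ σ x d tt         = ⇔.refl
  Sat-closeF ρ σ x d ff         = ⇔.refl
  Sat-closeF ρ σ x d (a ≐ b)    = ≡-cong-⇔ (evalT-closeT ρ σ x d a) (evalT-closeT ρ σ x d b)
  Sat-closeF ρ σ x d (rel r ts) = subst-⇔ (relI r) (evalTs-closeTs ρ σ x d ts)
  Sat-closeF ρ σ x d (¬' p)     = ¬-cong-⇔ (Sat-closeF ρ σ x d p)
  Sat-closeF ρ σ x d (p ∧' q)   = Sat-closeF ρ σ x d p ×-⇔ Sat-closeF ρ σ x d q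
  Sat-closeF ρ σ x d (p ∨' q)   = Sat-closeF ρ σ x d p ⊎-⇔ Sat-closeF ρ σ x d q
  Sat-closeF ρ σ x d (p ⇒' q)   = →-cong-⇔ (Sat-closeF ρ σ x d p) (Sat-closeF ρ σ x d q)
  Sat-closeF ρ σ x d (∀' p)     = ∀-cong-⇔ (λ e → Sat-closeF (e ∷ ρ) σ x d p)
  Sat-closeF ρ σ x d (∃' p)     = ∃-cong-⇔ (λ e → Sat-closeF (e ∷ ρ) σ x d p)

  ≗-except-upd₁ : ∀ {σ σ₁} x ws → σ₁ ≗ σ except (x ∷ ws) → σ₁ ≗ σ [ x ∷ [] ↦ σ₁ x ∷ [] ] except ws
  ≗-except-upd₁ {σ} {σ₁} x ws σ₁≗σ y y∉ws with y ≟ x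
  ... | yes refl = sym (upd-∈ σ σ₁ (x ∷ []) (here refl))
  ... | no  y≢x  = trans (σ₁≗σ y λ { (here y≡x) → y≢x y≡x ; (there y∈) → y∉ws y∈ })
                         (sym (upd-∉ σ (x ∷ []) (σ₁ x ∷ []) λ { (here y≡x) → y≢x y≡x }))

  ≗-except-upd₁⁻ : ∀ {σ σ₁} x d ws → σ₁ ≗ σ [ x ∷ [] ↦ d ∷ [] ] except ws → σ₁ ≗ σ except (x ∷ ws)
  ≗-except-upd₁⁻ {σ} x d ws σ₁≗σ′ y y∉ =
    trans (σ₁≗σ′ y (λ y∈ → y∉ (there y∈))) (upd-∉ σ (x ∷ []) (d ∷ []) λ { (here y≡x) → y∉ (here y≡x) })

  ∃s-intro : ∀ ws p {σ σ₁} → σ₁ ≗ σ except ws → σ₁ ⊨ p → σ ⊨ ∃s ws p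
  ∃s-intro []       p σ₁≗σ σ₁⊨p = ⊨-≗ p (λ y → σ₁≗σ y (λ ())) σ₁⊨p
  ∃s-intro (x ∷ ws) p {σ} {σ₁} σ₁≗σ σ₁⊨p =
    σ₁ x , from (Sat-closeF [] σ x (σ₁ x) (∃s ws p)) (∃s-intro ws p (≗-except-upd₁ x ws σ₁≗σ) σ₁⊨p)

  ∃s-elim : ∀ ws p {σ} → σ ⊨ ∃s ws p → Σ (State I) λ σ₁ → σ₁ ≗ σ except ws × σ₁ ⊨ p
  ∃s-elim []       p {σ} σ⊨p = σ , (λ _ _ → refl) , σ⊨p
  ∃s-elim (x ∷ ws) p {σ} (d , σ⊨) with ∃s-elim ws p (to (Sat-closeF [] σ x d (∃s ws p)) σ⊨)
  ... | σ₁ , σ₁≗σ′ , σ₁⊨p = σ₁ , ≗-except-upd₁⁻ x d ws σ₁≗σ′ , σ₁⊨p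

  ∀s-intro : ∀ ws p {σ} → (∀ σ₁ → σ₁ ≗ σ except ws → σ₁ ⊨ p) → σ ⊨ ∀s ws p
  ∀s-intro []       p h = h _ (λ _ _ → refl)
  ∀s-intro (x ∷ ws) p {σ} h d =
    from (Sat-closeF [] σ x d (∀s ws p)) (∀s-intro ws p λ σ₁ σ₁≗σ′ → h σ₁ (≗-except-upd₁⁻ x d ws σ₁≗σ′))

  ∀s-elim : ∀ ws p {σ} → σ ⊨ ∀s ws p → ∀ σ₁ → σ₁ ≗ σ except ws → σ₁ ⊨ p
  ∀s-elim []       p σ⊨ σ₁ σ₁≗σ = ⊨-≗ p (λ y → sym (σ₁≗σ y (λ ()))) σ⊨
  ∀s-elim (x ∷ ws) p {σ} σ⊨ σ₁ σ₁≗σ =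
    ∀s-elim ws p (to (Sat-closeF [] σ x (σ₁ x) (∀s ws p)) (σ⊨ (σ₁ x))) σ₁ (≗-except-upd₁ x ws σ₁≗σ)

  ⊨-equate : ∀ xs g {σ} → σ ⊨ equate xs g ⇔ All (λ x → σ x ≡ σ (g x)) xs
  ⊨-equate []       g = mk⇔ (λ _ → []) (λ _ → _)
  ⊨-equate (x ∷ xs) g =
    mk⇔ (λ (e , σ⊨) → e ∷ to (⊨-equate xs g) σ⊨) (λ { (e ∷ es) → e , from (⊨-equate xs g) es })

-- Executions

module Execution (L : Signature) (I : Lang.Interp L) (D : List (Lang.Decl L)) (N : ℕ)
                 (decl-below : Syntax.DeclsBelow L N D) where
  open Lang L hiding (_⊨_)
  open Semantics L I

  infix 4 ⟨_,_⟩⇓_ _≈ₚ_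

  ⟨_,_⟩⇓_ : Stmt → State I → State I → Set
  ⟨ S , σ ⟩⇓ τ = Exec I D S σ τ

  -- Agreement on the program variables, which all lie below N.
  _≈ₚ_ : State I → State I → Set
  σ ≈ₚ τ = ∀ y → y < N → σ y ≡ τ y

  Below : List Var → Set
  Below = All (_< N)

  below-block-body : ∀ {k} (xs : Vec Var k) (ts : Vec Exp k) S →
                     Below (toList xs ++ fvTs ts ++ varS S) → Below ((toList xs ++ fvTs ts) ++ varS S)
  below-block-body xs ts S = subst Below (sym (++-assoc (toList xs) (fvTs ts) (varS S)))

  below-call-block : ∀ {P k us u S ts} → decl P k us u S ∈ D → Below (fvTs ts) →
                     Below (varS (block k us u ts S))
  below-call-block {us = us} d∈ bts =
    All.++⁺ (All.++⁻ˡ (toList us) (decl-below d∈)) (All.++⁺ bts (All.++⁻ʳ (toList us) (decl-below d∈)))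

  frame : ∀ {S σ τ} → Below (varS S) → ⟨ S , σ ⟩⇓ τ → ∀ y → N ≤ y → τ y ≡ σ y
  frame b e-skip y N≤y = refl
  frame b (e-assign {σ = σ} {xs = xs}) y N≤y = upd-∉ σ xs _ (∉-above (All.++⁻ˡ (toList xs) b) N≤y)
  frame {S₁ ⨟ S₂} b (e-seq e₁ e₂) y N≤y =
    trans (frame (All.++⁻ʳ (varS S₁) b) e₂ y N≤y) (frame (All.++⁻ˡ (varS S₁) b) e₁ y N≤y)
  frame {ifte B S₁ S₂} b (e-if-t _ e) y N≤y =
    frame (All.++⁻ˡ (varS S₁) (All.++⁻ʳ (free (BExp.form B)) b)) e y N≤y
  frame {ifte B S₁ S₂} b (e-if-f _ e) y N≤y =
    frame (All.++⁻ʳ (varS S₁) (All.++⁻ʳ (free (BExp.form B)) b)) e y N≤y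
  frame {while B S} b (e-wh-t _ e₁ e₂) y N≤y =
    trans (frame b e₂ y N≤y) (frame (All.++⁻ʳ (free (BExp.form B)) b) e₁ y N≤y)
  frame b (e-wh-f _) y N≤y = refl
  frame b (e-block {τ = τ} {xs = xs} {ts = ts} {S = S} e) y N≤y =
    trans (upd-∉ τ xs _ (∉-above (All.++⁻ˡ (toList xs) b) N≤y)) (frame (below-block-body xs ts S b) e y N≤y)
  frame b (e-call {ts = ts} d∈ e) y N≤y = frame (below-call-block {ts = ts} d∈ b) e y N≤y

  ⊨-≈ₚ : ∀ p {σ σ′} → Below (free p) → σ ≈ₚ σ′ → σ ⊨ p → σ′ ⊨ p
  ⊨-≈ₚ p bp σ≈σ′ = ⊨-cong p (λ y∈ → σ≈σ′ _ (All.lookup bp y∈))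

  coincidence : ∀ {S σ σ′ τ} → Below (varS S) → σ ≈ₚ σ′ → ⟨ S , σ ⟩⇓ τ →
                Σ (State I) λ τ′ → ⟨ S , σ′ ⟩⇓ τ′ × τ ≈ₚ τ′
  coincidence {σ′ = σ′} b σ≈σ′ e-skip = σ′ , e-skip , σ≈σ′
  coincidence {σ = σ} {σ′} b σ≈σ′ (e-assign {xs = xs} {ts = ts}) =
    σ′ [ xs ↦ ⟦ ts ⟧ σ′ ] , e-assign ,
    λ y y<N → trans (cong (λ ds → (σ [ xs ↦ ds ]) y) (evalTs-cong [] ts λ y∈ → σ≈σ′ _ (All.lookup bts y∈)))
                    (upd-cong xs _ (λ _ → σ≈σ′ y y<N))
    where
    bts : Below (fvTs ts)
    bts = All.++⁻ʳ (toList xs) b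
  coincidence {S₁ ⨟ S₂} b σ≈σ′ (e-seq e₁ e₂) with coincidence (All.++⁻ˡ (varS S₁) b) σ≈σ′ e₁
  ... | σ₁′ , e₁′ , σ₁≈ with coincidence (All.++⁻ʳ (varS S₁) b) σ₁≈ e₂
  ...   | τ′ , e₂′ , τ≈ = τ′ , e-seq e₁′ e₂′ , τ≈
  coincidence {ifte B S₁ S₂} b σ≈σ′ (e-if-t σ⊨B e)
    with coincidence (All.++⁻ˡ (varS S₁) (All.++⁻ʳ (free (BExp.form B)) b)) σ≈σ′ e
  ... | τ′ , e′ , τ≈ = τ′ , e-if-t (⊨-≈ₚ (BExp.form B) (All.++⁻ˡ _ b) σ≈σ′ σ⊨B) e′ , τ≈
  coincidence {ifte B S₁ S₂} b σ≈σ′ (e-if-f σ⊭B e)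
    with coincidence (All.++⁻ʳ (varS S₁) (All.++⁻ʳ (free (BExp.form B)) b)) σ≈σ′ e
  ... | τ′ , e′ , τ≈ =
    τ′ , e-if-f (σ⊭B ∘ ⊨-≈ₚ (BExp.form B) (All.++⁻ˡ _ b) (λ y y<N → sym (σ≈σ′ y y<N))) e′ , τ≈
  coincidence {while B S} b σ≈σ′ (e-wh-t σ⊨B e₁ e₂)
    with coincidence (All.++⁻ʳ (free (BExp.form B)) b) σ≈σ′ e₁
  ... | σ₁′ , e₁′ , σ₁≈ with coincidence b σ₁≈ e₂
  ...   | τ′ , e₂′ , τ≈ = τ′ , e-wh-t (⊨-≈ₚ (BExp.form B) (All.++⁻ˡ _ b) σ≈σ′ σ⊨B) e₁′ e₂′ , τ≈
  coincidence {while B S} {σ′ = σ′} b σ≈σ′ (e-wh-f σ⊭B) =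
    σ′ , e-wh-f (σ⊭B ∘ ⊨-≈ₚ (BExp.form B) (All.++⁻ˡ _ b) (λ y y<N → sym (σ≈σ′ y y<N))) , σ≈σ′
  coincidence {σ = σ} {σ′} b σ≈σ′ (e-block {τ = τ} {xs = xs} {ts = ts} {S = S} e)
    with coincidence (below-block-body xs ts S b) σ≈σ′ e
  ... | τ′ , e′ , τ≈ =
    τ′ [ xs ↦ V.map σ′ xs ] , e-block e′ ,
    λ y y<N → trans (cong (λ ds → (τ [ xs ↦ ds ]) y) (map-cong-∈ xs λ x∈ → σ≈σ′ _ (All.lookup bxs x∈)))
                    (upd-cong xs _ (λ _ → τ≈ y y<N))
    where
    bxs : Below (toList xs)
    bxs = All.++⁻ˡ (toList xs) b
  coincidence b σ≈σ′ (e-call {ts = ts} d∈ e) with coincidence (below-call-block {ts = ts} d∈ b) σ≈σ′ e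
  ... | τ′ , e′ , τ≈ = τ′ , e-call d∈ e′ , τ≈

  below-or-above : ∀ y → y < N ⊎ N ≤ y
  below-or-above y = swap (≤-<-connex N y)

  coincidence-≗ : ∀ {S σ σ′ τ} → Below (varS S) → σ ≗ σ′ → ⟨ S , σ ⟩⇓ τ →
                  Σ (State I) λ τ′ → ⟨ S , σ′ ⟩⇓ τ′ × τ ≗ τ′
  coincidence-≗ {τ = τ} b σ≗σ′ e with coincidence b (λ y _ → σ≗σ′ y) e
  ... | τ′ , e′ , τ≈τ′ = τ′ , e′ , λ y → [ τ≈τ′ y , (λ N≤y → above y N≤y) ]′ (below-or-above y)
    where
    above : ∀ y → N ≤ y → τ y ≡ τ′ y
    above y N≤y = trans (frame b e y N≤y) (trans (σ≗σ′ y) (sym (frame b e′ y N≤y)))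

-- Completeness

module Completeness (L : Signature) (I : Lang.Interp L) (expressive : Lang.Expressive L I)
                    (D : List (Lang.Decl L)) (S₀ : Lang.Stmt L) (wf : Lang.WFProg L D S₀)
                    (N : ℕ) (program-below : All (_< N) (Lang.varP L D S₀)) where
  open Lang L hiding (_⊨_)
  open Syntax L
  open Semantics L I
  open Interp I using (Carrier)

  decls-below : All (_< N) (concatMap (λ d → toList (params d) ++ varS (body d)) D)
  decls-below = All.++⁻ʳ (varS S₀) program-below

  decl-below : DeclsBelow N D
  decl-below d∈ = All.lookup (All.map⁻ (All.concat⁻ decls-below)) d∈

  open Execution L I D N decl-below

  varP-below : ∀ S → Below (varS S) → Below (varP D S)
  varP-below S bS = All.++⁺ bS decls-below

  change-below : ∀ S → Below (varS S) → Below (changeP D S)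
  change-below S bS = All-chg _ S bS (λ P → call-change-below (findDecl D P))
    where
    changeD-below : Below (changeD D)
    changeD-below = All.concat⁺ (All.map⁺ (All.tabulate λ {d} d∈ →
      All-chg (λ _ → []) (body d) (All.++⁻ʳ (toList (params d)) (decl-below d∈)) (λ _ → [])))

    call-change-below : ∀ m → Below (maybe (λ d → changeD D ∖ toList (params d)) [] m)
    call-change-below (just d) = All.filter⁺ _ changeD-below
    call-change-below nothing  = []

  name-injective : ∀ {d d′} → d ∈ D → d′ ∈ D → name d ≡ name d′ → d ≡ d′
  name-injective = go (proj₁ wf)
    where
    go : ∀ {E : List Decl} → Unique (map name E) → ∀ {d d′} → d ∈ E → d′ ∈ E → name d ≡ name d′ → d ≡ d′
    go _               (here refl) (here refl) _  = refl
    go (ne AP.∷ _)     (here refl) (there d′∈) n≡n′ = ⊥-elim (All.lookup ne (∈-map⁺ name d′∈) n≡n′)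
    go (ne AP.∷ _)     (there d∈)  (here refl) n≡n′ = ⊥-elim (All.lookup ne (∈-map⁺ name d∈) (sym n≡n′))
    go (_  AP.∷ uniq)  (there d∈)  (there d′∈) n≡n′ = go uniq d∈ d′∈ n≡n′

  findDecl-∈ : ∀ {d} → d ∈ D → findDecl D (name d) ≡ just d
  findDecl-∈ = go (proj₁ wf)
    where
    go : ∀ {E : List Decl} → Unique (map name E) → ∀ {d} → d ∈ E → findDecl E (name d) ≡ just d
    go {d′ ∷ E} (ne AP.∷ uniq) {d} d∈ with does (name d′ ≟ name d) | proof (name d′ ≟ name d) | d∈
    ... | true  | _         | here refl = refl
    ... | true  | ofʸ n≡n′    | there d∈′ = ⊥-elim (All.lookup ne (∈-map⁺ name d∈′) n≡n′)
    ... | false | ofⁿ n≢n′   | here refl = ⊥-elim (n≢n′ refl)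
    ... | false | _         | there d∈′ = go uniq d∈′

  change-call : ∀ {P k us u B ts} → decl P k us u B ∈ D → All (_∉ toList us) (changeP D (call P k ts))
  change-call {us = us} d∈ rewrite findDecl-∈ d∈ = All.all-filter (λ x → ¬? (x ∈? toList us)) (changeD D)

  change-block : ∀ {k xs u ts S} → All (_∉ toList xs) (changeP D (block k xs u ts S))
  change-block {xs = xs} {S = S} = All.all-filter (λ x → ¬? (x ∈? toList xs)) (changeP D S)

  Declared : ℕ × ℕ → Set
  Declared c = Σ Decl λ d → d ∈ D × name d ≡ proj₁ c × arity d ≡ proj₂ c

  declared? : ∀ c → Dec (Declared c)
  declared? (P , k) =
    Dec.map′ find (λ (d , d∈ , n≡n′) → lose d∈ n≡n′) (any? (λ d → (name d ≟ P) ×-dec (arity d ≟ k)) D)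

  CallsDeclared : Stmt → Set
  CallsDeclared S = All Declared (callsS S)

  bodies-declared : All Declared (concatMap (λ d → callsS (body d)) D)
  bodies-declared = All.++⁻ʳ (callsS S₀) (proj₂ wf)

  body-declared : ∀ {d} → d ∈ D → CallsDeclared (body d)
  body-declared d∈ = All.lookup (All.map⁻ (All.concat⁻ bodies-declared)) d∈

  calls-declared⇒wf : ∀ S → CallsDeclared S → WFProg D S
  calls-declared⇒wf S cS = proj₁ wf , All.++⁺ cS bodies-declared

  sp : Assertion → (S : Stmt) → CallsDeclared S → Assertion
  sp p S cS = proj₁ (expressive p D S (calls-declared⇒wf S cS))

  ⊨-sp : ∀ p S cS {σ} → σ ⊨ sp p S cS ⇔ (Σ (State I) λ τ → τ ⊨ p × ⟨ S , τ ⟩⇓ σ)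
  ⊨-sp p S cS {σ} = proj₂ (expressive p D S (calls-declared⇒wf S cS)) σ

  -- Copies of the program variables

  x̄ : Vec Var N
  x̄ = allBelow N

  x̄-below : Below (toList x̄)
  x̄-below = All.tabulate ∈-allBelow⁻

  ∉x̄⇒≥ : ∀ {y} → y ∉ toList x̄ → N ≤ y
  ∉x̄⇒≥ y∉x̄ = ≮⇒≥ (λ y<N → y∉x̄ (∈-allBelow⁺ y<N))

  All-x̄ : ∀ {P : Var → Set} → All P (toList x̄) ⇔ (∀ i → i < N → P i)
  All-x̄ = mk⇔ (λ Px̄ i i<N → All.lookup Px̄ (∈-allBelow⁺ i<N))
              (λ P< → All.tabulate (λ i∈ → P< _ (∈-allBelow⁻ i∈)))

  copy : ℕ → Vec Var N
  copy K = V.map (K +_) x̄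

  z̄ : Vec Var N
  z̄ = copy N

  shift-≥ : ∀ K {n} (xs : Vec Var n) → All (K ≤_) (toList (V.map (K +_) xs))
  shift-≥ K xs = All.tabulate λ y∈ → let x , _ , y≡K+x = ∈-toList-map⁻ (K +_) y∈ in
    subst (K ≤_) (sym y≡K+x) (m≤m+n K x)

  copy-< : ∀ K → All (_< K + N) (toList (copy K))
  copy-< K = All.tabulate λ y∈ → let x , x∈ , y≡K+x = ∈-toList-map⁻ (K +_) y∈ in
    subst (_< K + N) (sym y≡K+x) (+-monoʳ-< K (∈-allBelow⁻ x∈))

  ∉-copy : ∀ {K y} → y < K ⊎ K + N ≤ y → y ∉ toList (copy K)
  ∉-copy (inj₁ y<K)   y∈ = <⇒≱ y<K (All.lookup (shift-≥ _ x̄) y∈)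
  ∉-copy (inj₂ K+N≤y) y∈ = <⇒≱ (All.lookup (copy-< _) y∈) K+N≤y

  unique-copy : ∀ K → Unique (toList (copy K))
  unique-copy K = subst Unique (sym (V.toList-map (K +_) x̄))
    (Unique.map⁺ (+-cancelˡ-≡ K _ _) (subst Unique (sym (toList-allBelow N)) (Unique.downFrom⁺ N)))

  -- Fresh variables: above the program variables x̄, their frozen copies z̄, and vs.
  beyond : List Var → ℕ
  beyond vs = N + N + fresh vs

  N+N≤beyond : ∀ vs → N + N ≤ beyond vs
  N+N≤beyond vs = m≤m+n (N + N) (fresh vs)

  <-beyond : ∀ vs → All (_< beyond vs) vs
  <-beyond vs = All.map (λ y<f → <-≤-trans y<f (m≤n+m (fresh vs) (N + N))) (<-fresh vs)

  <N⇒<beyond : ∀ vs {y} → y < N → y < beyond vs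
  <N⇒<beyond vs y<N = <-≤-trans y<N (≤-trans (m≤m+n N N) (N+N≤beyond vs))

  N+N≤beyond+ : ∀ vs y → N + N ≤ beyond vs + y
  N+N≤beyond+ vs y = ≤-trans (N+N≤beyond vs) (m≤m+n (beyond vs) y)

  N≤beyond : ∀ vs → N ≤ beyond vs
  N≤beyond vs = ≤-trans (m≤m+n N N) (N+N≤beyond vs)

  N≤beyond+ : ∀ vs y → N ≤ beyond vs + y
  N≤beyond+ vs y = ≤-trans (m≤m+n N N) (N+N≤beyond+ vs y)

  load : ℕ → State I → State I
  load K σ = σ [ x̄ ↦ V.map σ (copy K) ]

  store : ℕ → (Var → Carrier) → State I → State I
  store K g σ = σ [ copy K ↦ V.map g x̄ ]

  load-below : ∀ K σ {y} → y < N → load K σ y ≡ σ (K + y)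
  load-below K σ {y} y<N =
    trans (cong (λ ds → (σ [ x̄ ↦ ds ]) y) (sym (V.map-∘ σ (K +_) x̄)))
          (upd-∈ σ (σ ∘ (K +_)) x̄ (∈-allBelow⁺ y<N))

  load-above : ∀ K σ {y} → N ≤ y → load K σ y ≡ σ y
  load-above K σ N≤y = upd-∉ σ x̄ (V.map σ (copy K)) (∉-above x̄-below N≤y)

  store-copy : ∀ K g σ {i} → i < N → store K g σ (K + i) ≡ g i
  store-copy K g σ i<N = upd-map-∈ σ (+-cancelˡ-≡ K _ _) g x̄ (∈-allBelow⁺ i<N)

  store-other : ∀ K g σ {y} → y < K ⊎ K + N ≤ y → store K g σ y ≡ σ y
  store-other K g σ y∉ = upd-∉ σ (copy K) (V.map g x̄) (∉-copy y∉)

  ⊨-load : ∀ K σ p → σ ⊨ p [ x̄ ≔ V.map fv (copy K) ] ⇔ load K σ ⊨ p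
  ⊨-load K = ⊨-rename x̄ (copy K)

  ⊨-save : ∀ K σ p → σ ⊨ p [ copy K ≔ V.map fv x̄ ] ⇔ store K σ σ ⊨ p
  ⊨-save K = ⊨-rename (copy K) x̄

  ⊨-move : ∀ K K′ σ p → σ ⊨ p [ copy K ≔ V.map fv (copy K′) ] ⇔ store K (σ ∘ (K′ +_)) σ ⊨ p
  ⊨-move K K′ σ p = subst (λ ds → σ ⊨ p [ copy K ≔ V.map fv (copy K′) ] ⇔ σ [ copy K ↦ ds ] ⊨ p)
                          (sym (V.map-∘ σ (K′ +_) x̄)) (⊨-rename (copy K) (copy K′) σ p)

  ⊨-x̄≐copy : ∀ K {σ} → σ ⊨ equate (toList x̄) (K +_) ⇔ (∀ i → i < N → σ i ≡ σ (K + i))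
  ⊨-x̄≐copy K = ⇔.trans (⊨-equate (toList x̄) (K +_)) All-x̄

  -- Procedure specifications

  x̄≐z̄ : Assertion
  x̄≐z̄ = equate (toList x̄) (N +_)

  ⊨-x̄≐z̄-store : ∀ g σ → store N g σ ⊨ x̄≐z̄ ⇔ (∀ i → i < N → σ i ≡ g i)
  ⊨-x̄≐z̄-store g σ = ⇔.trans (⊨-x̄≐copy N) (mk⇔
    (λ h i i<N → trans (sym (store-other N g σ (inj₁ i<N))) (trans (h i i<N) (store-copy N g σ i<N)))
    (λ h i i<N → trans (store-other N g σ (inj₁ i<N)) (trans (h i i<N) (sym (store-copy N g σ i<N)))))

  save-frozen : ∀ σ → store N σ σ ⊨ x̄≐z̄
  save-frozen σ = from (⊨-x̄≐z̄-store σ σ) (λ _ _ → refl)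

  -- Only declarations in D are ever specified, so the junk value ff is never used.
  call-sp : Decl → Assertion
  call-sp d with declared? (name d , arity d)
  ... | yes d-declared = sp x̄≐z̄ (callOf d) (d-declared ∷ [])
  ... | no  _          = ff

  ⊨-call-sp : ∀ {d} → d ∈ D → ∀ {σ} → σ ⊨ call-sp d ⇔ (Σ (State I) λ τ → τ ⊨ x̄≐z̄ × ⟨ callOf d , τ ⟩⇓ σ)
  ⊨-call-sp {d} d∈ with declared? (name d , arity d)
  ... | yes d-declared = ⊨-sp x̄≐z̄ (callOf d) (d-declared ∷ [])
  ... | no  undeclared = ⊥-elim (undeclared (d , d∈ , refl , refl))

  spec-pre spec-post : Decl → Assertion
  spec-pre _  = x̄≐z̄
  spec-post d = ∃s (toList (params d)) (call-sp d)

  ⊢⟪_⟫_⟪_⟫ : Assertion → Stmt → Assertion → Set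
  ⊢⟪ p ⟫ S ⟪ q ⟫ = Pf I D false (specs D spec-pre spec-post) ⟪ p ⟫ S ⟪ q ⟫

  ⊨⟪_⟫_⟪_⟫ : Assertion → Stmt → Assertion → Set
  ⊨⟪ p ⟫ S ⟪ q ⟫ = Valid I D p S q

  Complete : Stmt → Set
  Complete S = ∀ p q → ⊨⟪ p ⟫ S ⟪ q ⟫ → ⊢⟪ p ⟫ S ⟪ q ⟫

  complete-skip : Complete skip
  complete-skip p q ⊨pq = consequence {p₁ = p} {q₁ = p} (λ _ → id) skip-ax (λ σ σ⊨p → ⊨pq σ σ σ⊨p e-skip)

  complete-assign : ∀ {k xs u ts} → Complete (assign k xs u ts)
  complete-assign {xs = xs} {ts = ts} p q ⊨pq =
    consequence {p₁ = q [ xs ≔ ts ]} {q₁ = q} (λ σ σ⊨p → from (⊨-subst xs ts σ q) (⊨pq σ _ σ⊨p e-assign))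
                assign-ax (λ _ → id)

  complete-⨟ : ∀ {S₁ S₂} → CallsDeclared S₁ → Complete S₁ → Complete S₂ → Complete (S₁ ⨟ S₂)
  complete-⨟ {S₁} {S₂} c₁ complete₁ complete₂ p q ⊨pq =
    composition (complete₁ p r ⊨p-r) (complete₂ r q ⊨r-q)
    where
    r : Assertion
    r = sp p S₁ c₁

    ⊨p-r : ⊨⟪ p ⟫ S₁ ⟪ r ⟫
    ⊨p-r σ τ σ⊨p e = from (⊨-sp p S₁ c₁) (σ , σ⊨p , e)

    ⊨r-q : ⊨⟪ r ⟫ S₂ ⟪ q ⟫
    ⊨r-q σ τ σ⊨r e₂ = let σ₀ , σ₀⊨p , e₁ = to (⊨-sp p S₁ c₁) σ⊨r in ⊨pq σ₀ τ σ₀⊨p (e-seq e₁ e₂)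

  complete-if : ∀ {B S₁ S₂} → Complete S₁ → Complete S₂ → Complete (ifte B S₁ S₂)
  complete-if complete₁ complete₂ p q ⊨pq =
    conditional (complete₁ _ q λ σ τ (σ⊨p , σ⊨B) e → ⊨pq σ τ σ⊨p (e-if-t σ⊨B e))
                (complete₂ _ q λ σ τ (σ⊨p , σ⊭B) e → ⊨pq σ τ σ⊨p (e-if-f σ⊭B e))

  -- ȳ holds a final state of S, and φ relates it to the current state, frozen in z̄.
  module WeakestPrecondition (S : Stmt) (cS : CallsDeclared S) (q : Assertion) where
    M : ℕ
    M = beyond (free q)

    ȳ : Vec Var N
    ȳ = copy M

    <N⇒<M : ∀ {y} → y < N → y < M
    <N⇒<M = <N⇒<beyond (free q)

    φ : Assertion
    φ = sp x̄≐z̄ S cS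

    reaches : Assertion
    reaches = (φ [ x̄ ≔ V.map fv ȳ ]) [ z̄ ≔ V.map fv x̄ ]

    wlp : Assertion
    wlp = ∀s (toList ȳ) (reaches ⇒' (q [ x̄ ≔ V.map fv ȳ ]))

    final : State I → State I
    final σ₁ = load M (store N σ₁ σ₁)

    ⊨-reaches : ∀ σ₁ → σ₁ ⊨ reaches ⇔ final σ₁ ⊨ φ
    ⊨-reaches σ₁ = ⇔.trans (⊨-save N σ₁ (φ [ x̄ ≔ V.map fv ȳ ])) (⊨-load M (store N σ₁ σ₁) φ)

    final-below : ∀ σ₁ {y} → y < N → final σ₁ y ≡ σ₁ (M + y)
    final-below σ₁ {y} y<N =
      trans (load-below M (store N σ₁ σ₁) y<N) (store-other N σ₁ σ₁ (inj₂ (N+N≤beyond+ (free q) y)))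

    module _ (bS : Below (varS S)) where
      wlp-sound : ∀ {σ τ} → σ ⊨ wlp → ⟨ S , σ ⟩⇓ τ → τ ⊨ q
      wlp-sound {σ} {τ} σ⊨wlp e = ⊨-cong q agree (to (⊨-load M σ₁ q) (σ₁⊨R (from (⊨-reaches σ₁) final⊨φ)))
        where
        σ₁ : State I
        σ₁ = store M τ σ

        σ₁⊨R : σ₁ ⊨ reaches ⇒' (q [ x̄ ≔ V.map fv ȳ ])
        σ₁⊨R = ∀s-elim (toList ȳ) _ σ⊨wlp σ₁ (λ y y∉ȳ → upd-∉ σ ȳ (V.map τ x̄) y∉ȳ)

        σ≈frozen : σ ≈ₚ store N σ₁ σ₁
        σ≈frozen y y<N = sym (trans (store-other N σ₁ σ₁ (inj₁ y<N)) (store-other M τ σ (inj₁ (<N⇒<M y<N))))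

        final⊨φ : final σ₁ ⊨ φ
        final⊨φ with coincidence bS σ≈frozen e
        ... | τ′ , e′ , τ≈τ′ = ⊨-≗ φ τ′≗final (from (⊨-sp x̄≐z̄ S cS) (store N σ₁ σ₁ , save-frozen σ₁ , e′))
          where
          τ′≗final : τ′ ≗ final σ₁
          τ′≗final y = [ (λ y<N → sym (trans (final-below σ₁ y<N) (trans (store-copy M τ σ y<N) (τ≈τ′ y y<N))))
                       , (λ N≤y → trans (frame bS e′ y N≤y) (sym (load-above M (store N σ₁ σ₁) N≤y))) ]′
                       (below-or-above y)

        agree : ∀ {y} → y ∈ free q → load M σ₁ y ≡ τ y
        agree {y} y∈ = [ (λ y<N → trans (load-below M σ₁ y<N) (store-copy M τ σ y<N))
                       , (λ N≤y → trans (load-above M σ₁ N≤y)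
                                   (trans (store-other M τ σ (inj₁ (All.lookup (<-beyond (free q)) y∈)))
                                          (sym (frame bS e y N≤y)))) ]′ (below-or-above y)

      wlp-complete : ∀ {σ} → (∀ τ → ⟨ S , σ ⟩⇓ τ → τ ⊨ q) → σ ⊨ wlp
      wlp-complete {σ} runs⊨q = ∀s-intro (toList ȳ) _ ⊨R
        where
        ⊨R : ∀ σ₁ → σ₁ ≗ σ except toList ȳ → σ₁ ⊨ reaches ⇒' (q [ x̄ ≔ V.map fv ȳ ])
        ⊨R σ₁ σ₁≗σ σ₁⊨reaches with to (⊨-sp x̄≐z̄ S cS) (to (⊨-reaches σ₁) σ₁⊨reaches)
        ... | τ₀ , τ₀⊨x̄≐z̄ , e₀ with coincidence bS τ₀≈σ e₀
          where
          τ₀≈σ : τ₀ ≈ₚ σ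
          τ₀≈σ i i<N = begin
            τ₀ i                     ≡⟨ to (⊨-x̄≐copy N) τ₀⊨x̄≐z̄ i i<N ⟩
            τ₀ (N + i)               ≡⟨ sym (frame bS e₀ (N + i) (m≤m+n N i)) ⟩
            final σ₁ (N + i)         ≡⟨ load-above M (store N σ₁ σ₁) (m≤m+n N i) ⟩
            store N σ₁ σ₁ (N + i)    ≡⟨ store-copy N σ₁ σ₁ i<N ⟩
            σ₁ i                     ≡⟨ σ₁≗σ i (∉-copy (inj₁ (<N⇒<M i<N))) ⟩
            σ i                      ∎
        ... | τ , e , final≈τ = from (⊨-load M σ₁ q) (⊨-cong q agree (runs⊨q τ e))
          where
          agree : ∀ {y} → y ∈ free q → τ y ≡ load M σ₁ y
          agree {y} y∈ =
            [ (λ y<N → trans (sym (final≈τ y y<N)) (trans (final-below σ₁ y<N) (sym (load-below M σ₁ y<N))))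
            , (λ N≤y → trans (frame bS e y N≤y)
                       (trans (sym (σ₁≗σ y (∉-copy (inj₁ (All.lookup (<-beyond (free q)) y∈)))))
                              (sym (load-above M σ₁ N≤y)))) ]′ (below-or-above y)

  complete-while : ∀ {B S} → Below (varS (while B S)) → CallsDeclared S → Complete S → Complete (while B S)
  complete-while {B} {S} bW cS complete-S p q ⊨pq =
    consequence (λ σ σ⊨p → wlp-complete bW (λ τ → ⊨pq σ τ σ⊨p))
                (loop (complete-S (wlp ∧' BExp.form B) wlp ⊨invariant))
                (λ σ (σ⊨wlp , σ⊭B) → wlp-sound bW σ⊨wlp (e-wh-f σ⊭B))
    where
    open WeakestPrecondition (while B S) cS q

    ⊨invariant : ⊨⟪ wlp ∧' BExp.form B ⟫ S ⟪ wlp ⟫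
    ⊨invariant σ σ′ (σ⊨wlp , σ⊨B) e = wlp-complete bW (λ τ e′ → wlp-sound bW σ⊨wlp (e-wh-t σ⊨B e e′))

  -- The old values of the local variables xs are kept in fresh variables ȳ.
  module Block {k} (xs : Vec Var k) (u : Unique (toList xs)) (ts : Vec Exp k) (B : Stmt)
               (bblock : Below (varS (block k xs u ts B))) (p q : Assertion)
               (⊨pq : ⊨⟪ p ⟫ block k xs u ts B ⟪ q ⟫) where
    M : ℕ
    M = beyond (free p ++ free q)

    ȳ : Vec Var k
    ȳ = V.map (M +_) xs

    xs≐ȳ : Assertion
    xs≐ȳ = equate (toList xs) (M +_)

    q′ : Assertion
    q′ = q [ xs ≔ V.map fv ȳ ]

    <N⇒<M : ∀ {y} → y < N → y < M
    <N⇒<M = <N⇒<beyond (free p ++ free q)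

    N≤M+ : ∀ x → N ≤ M + x
    N≤M+ = N≤beyond+ (free p ++ free q)

    xs<M : All (_< M) (toList xs)
    xs<M = All.map <N⇒<M (All.++⁻ˡ (toList xs) bblock)

    ⊨body : ⊨⟪ p ∧' xs≐ȳ ⟫ assign k xs u ts ⨟ B ⟪ q′ ⟫
    ⊨body σ ρ (σ⊨p , σ⊨xs≐ȳ) e = from (⊨-rename xs ȳ ρ q) (subst (_⊨ q) restored (⊨pq σ _ σ⊨p (e-block e)))
      where
      restored : ρ [ xs ↦ V.map σ xs ] ≡ ρ [ xs ↦ V.map ρ ȳ ]
      restored = cong (λ ds → ρ [ xs ↦ ds ]) (trans (map-cong-∈ xs σx≡ρM+x) (V.map-∘ ρ (M +_) xs))
        where
        σx≡ρM+x : ∀ {x} → x ∈ toList xs → σ x ≡ ρ (M + x)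
        σx≡ρM+x {x} x∈ = trans (All.lookup (to (⊨-equate (toList xs) (M +_)) σ⊨xs≐ȳ) x∈)
                               (sym (frame (below-block-body xs ts B bblock) e (M + x) (N≤M+ x)))

    back : ∀ τ → τ ⊨ xs≐ȳ ∧' q′ → τ ⊨ q
    back τ (τ⊨xs≐ȳ , τ⊨q′) =
      ⊨-≗ q (λ y → trans (cong (λ ds → (τ [ xs ↦ ds ]) y) restored) (upd-self τ xs y))
            (to (⊨-rename xs ȳ τ q) τ⊨q′)
      where
      restored : V.map τ ȳ ≡ V.map τ xs
      restored = trans (sym (V.map-∘ τ (M +_) xs))
                       (map-cong-∈ xs λ x∈ → sym (All.lookup (to (⊨-equate (toList xs) (M +_)) τ⊨xs≐ȳ) x∈))

    fwd : ∀ σ → σ ⊨ p → σ ⊨ ∃s (toList ȳ) (xs≐ȳ ∧' (p ∧' xs≐ȳ))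
    fwd σ σ⊨p = ∃s-intro (toList ȳ) _ σ′≗σ (σ′⊨xs≐ȳ , σ′⊨p , σ′⊨xs≐ȳ)
      where
      σ′ : State I
      σ′ = σ [ ȳ ↦ V.map σ xs ]

      σ′≗σ : σ′ ≗ σ except toList ȳ
      σ′≗σ y y∉ȳ = upd-∉ σ ȳ (V.map σ xs) y∉ȳ

      ∉ȳ : ∀ {y} → y < M → y ∉ toList ȳ
      ∉ȳ y<M y∈ȳ = <⇒≱ y<M (All.lookup (shift-≥ M xs) y∈ȳ)

      σ′⊨xs≐ȳ : σ′ ⊨ xs≐ȳ
      σ′⊨xs≐ȳ = from (⊨-equate (toList xs) (M +_)) (All.tabulate λ {x} x∈ →
        trans (σ′≗σ x (∉ȳ (All.lookup xs<M x∈))) (sym (upd-map-∈ σ (+-cancelˡ-≡ M _ _) σ xs x∈)))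

      σ′⊨p : σ′ ⊨ p
      σ′⊨p = ⊨-cong p (λ y∈ → sym (σ′≗σ _ (∉ȳ (All.lookup (<-beyond (free p ++ free q)) (∈-++⁺ˡ y∈))))) σ⊨p

    xs#q′ : Disjoint (toList xs) (free q′)
    xs#q′ = All∉⇒Disjoint (free-substF xs (V.map fv ȳ) ȳ∉xs q (λ _ y∉ → y∉))
      where
      ȳ∉xs : All (_∉ toList xs) (fvTs (V.map fv ȳ))
      ȳ∉xs = subst (All (_∉ toList xs)) (sym (fvTs-map-fv ȳ)) (All.map (∉-above xs<M) (shift-≥ M xs))

    xs≐ȳ#change : Disjoint (free xs≐ȳ) (changeP D (block k xs u ts B))
    xs≐ȳ#change = Disjoint.sym (All∉⇒Disjoint (free-equate (toList xs) (M +_)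
      (All.tabulate λ x∈ x∈c → All.lookup (change-block {k} {xs} {u} {ts} {B}) x∈c x∈)
      (All.tabulate λ {x} _ → ∉-above (change-below (block k xs u ts B) bblock) (N≤M+ x))))

    ȳ#vars : Disjoint (toList ȳ) (varP D (block k xs u ts B) ++ free q)
    ȳ#vars = separated⇒Disjoint M (shift-≥ M xs)
      (All.++⁺ (All.map <N⇒<M (varP-below (block k xs u ts B) bblock))
               (All.++⁻ʳ (free p) (<-beyond (free p ++ free q))))

  complete-block : ∀ {k xs u ts B} → Below (varS (block k xs u ts B)) → Complete B →
                   Complete (block k xs u ts B)
  complete-block {k} {xs} {u} {ts} {B} bblock complete-B p q ⊨pq =
    consequence {q₁ = q} fwd (∃-intro (toList ȳ) (consequence (λ _ → id) invariant back) ȳ#vars) (λ _ → id)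
    where
    open Block xs u ts B bblock p q ⊨pq

    invariant : ⊢⟪ xs≐ȳ ∧' (p ∧' xs≐ȳ) ⟫ block k xs u ts B ⟪ xs≐ȳ ∧' q′ ⟫
    invariant =
      invariance (block-rule (complete-⨟ [] complete-assign complete-B _ _ ⊨body) xs#q′) xs≐ȳ#change

  -- Procedure calls

  call-inversion : ∀ {P k us u B ts σ τ} → decl P k us u B ∈ D → ⟨ call P k ts , σ ⟩⇓ τ →
                   Σ (State I) λ ρ → ⟨ B , σ [ us ↦ ⟦ ts ⟧ σ ] ⟩⇓ ρ × τ ≡ ρ [ us ↦ V.map σ us ]
  call-inversion d∈ (e-call d′∈ (e-block (e-seq e-assign e))) with name-injective d∈ d′∈ refl
  ... | refl = _ , e , refl

  module _ {P k us u B} (d∈ : decl P k us u B ∈ D) where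
    private
      bus : Below (toList us)
      bus = All.++⁻ˡ (toList us) (decl-below d∈)

      bB : Below (varS B)
      bB = All.++⁻ʳ (toList us) (decl-below d∈)

      bcall : Below (varS (call P k (V.map fv us)))
      bcall = subst Below (sym (fvTs-map-fv us)) bus

    spec-post-sound : ∀ {τ} → τ ⊨ spec-post (decl P k us u B) → ∀ s → (∀ i → i < N → s i ≡ τ (N + i)) →
                      Σ (State I) λ ρ → ⟨ B , s ⟩⇓ ρ × (∀ y → y < N → y ∉ toList us → ρ y ≡ τ y)
    spec-post-sound {τ} τ⊨post s s≡τN+ with ∃s-elim (toList us) _ τ⊨post
    ... | τ₁ , τ₁≗τ , τ₁⊨sp with to (⊨-call-sp d∈) τ₁⊨sp
    ... | τ₀ , τ₀⊨x̄≐z̄ , ecall with call-inversion d∈ ecall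
    ... | ρ₀ , e₀ , refl with coincidence bB entry≈s e₀
      where
      entry≈s : τ₀ [ us ↦ ⟦ V.map fv us ⟧ τ₀ ] ≈ₚ s
      entry≈s i i<N = begin
        (τ₀ [ us ↦ ⟦ V.map fv us ⟧ τ₀ ]) i  ≡⟨ upd-self-fv τ₀ us i ⟩
        τ₀ i                                ≡⟨ to (⊨-x̄≐copy N) τ₀⊨x̄≐z̄ i i<N ⟩
        τ₀ (N + i)                          ≡⟨ sym (frame bcall ecall (N + i) (m≤m+n N i)) ⟩
        τ₁ (N + i)                          ≡⟨ τ₁≗τ (N + i) (∉-above bus (m≤m+n N i)) ⟩
        τ (N + i)                           ≡⟨ sym (s≡τN+ i i<N) ⟩
        s i                                 ∎
    ... | ρ , e , ρ₀≈ρ =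
      ρ , e , λ y y<N y∉us →
        trans (sym (ρ₀≈ρ y y<N)) (trans (sym (upd-∉ ρ₀ us (V.map τ₀ us) y∉us)) (τ₁≗τ y y∉us))

    spec-body-valid : ⊨⟪ x̄≐z̄ ⟫ B ⟪ spec-post (decl P k us u B) ⟫
    spec-body-valid σ τ σ⊨x̄≐z̄ e with coincidence-≗ bB (λ y → sym (upd-self-fv σ us y)) e
    ... | ρ , e′ , τ≗ρ =
      ∃s-intro (toList us) _ (λ y y∉us → upd-∉ τ us (V.map σ us) y∉us)
        (⊨-≗ (call-sp (decl P k us u B)) (λ y → upd-cong us (V.map σ us) (λ _ → sym (τ≗ρ y)))
             (from (⊨-call-sp d∈) (σ , σ⊨x̄≐z̄ , e-call d∈ (e-block (e-seq e-assign e′)))))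

  -- The state before the call is kept in w̄, the state on entry to the body in ȳ; the latter
  -- replaces the frozen copy z̄ in the specification of P.
  module Call {P k ū u B} (d∈ : decl P k ū u B ∈ D) (t̄ : Vec Exp k) (bt̄ : Below (fvTs t̄))
              (p q : Assertion) (⊨pq : ⊨⟪ p ⟫ call P k t̄ ⟪ q ⟫) where
    d : Decl
    d = decl P k ū u B

    M : ℕ
    M = beyond (free p ++ free q)

    w̄ ȳ : Vec Var N
    w̄ = copy M
    ȳ = copy (M + N)

    entry : State I → State I
    entry σ = σ [ ū ↦ ⟦ t̄ ⟧ σ ]

    pre′ post′ π : Assertion
    pre′  = (x̄≐z̄ [ z̄ ≔ V.map fv ȳ ]) [ ū ≔ t̄ ]
    post′ = spec-post d [ z̄ ≔ V.map fv ȳ ]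
    π     = ((p ∧' pre′) [ x̄ ≔ V.map fv w̄ ]) ∧' equate (toList ū) (M +_)

    <N⇒<M : ∀ {y} → y < N → y < M
    <N⇒<M = <N⇒<beyond (free p ++ free q)

    N≤M : N ≤ M
    N≤M = N≤beyond (free p ++ free q)

    N≤M+ : ∀ x → N ≤ M + x
    N≤M+ = N≤beyond+ (free p ++ free q)

    bū : Below (toList ū)
    bū = All.++⁻ˡ (toList ū) (decl-below d∈)

    ȳ-≥ : All (M + N ≤_) (toList ȳ)
    ȳ-≥ = shift-≥ (M + N) x̄

    N≤M+N+ : ∀ i → N ≤ M + N + i
    N≤M+N+ i = ≤-trans (m≤n+m N M) (m≤m+n (M + N) i)

    ⊨pre′ : ∀ s → s ⊨ pre′ ⇔ (∀ i → i < N → entry s i ≡ entry s (M + N + i))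
    ⊨pre′ s = ⇔.trans (⊨-subst ū t̄ s (x̄≐z̄ [ z̄ ≔ V.map fv ȳ ]))
                      (⇔.trans (⊨-move N (M + N) (entry s) x̄≐z̄) (⊨-x̄≐z̄-store _ (entry s)))

    fwd : ∀ σ → σ ⊨ p → σ ⊨ ∃s (toList w̄ ++ toList ȳ) (π ∧' pre′)
    fwd σ σ⊨p = ∃s-intro (toList w̄ ++ toList ȳ) (π ∧' pre′) σ′≗σ ((σ′⊨p∧pre′[w̄] , σ′⊨ū≐w̄) , σ′⊨pre′)
      where
      σ′ : State I
      σ′ = store M σ (store (M + N) (entry σ) σ)

      σ′≗σ : σ′ ≗ σ except (toList w̄ ++ toList ȳ)
      σ′≗σ y y∉ = trans (upd-∉ _ w̄ (V.map σ x̄) (λ y∈ → y∉ (∈-++⁺ˡ y∈)))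
                        (upd-∉ σ ȳ (V.map (entry σ) x̄) (λ y∈ → y∉ (∈-++⁺ʳ (toList w̄) y∈)))

      σ′-below : ∀ y → y < M → σ′ y ≡ σ y
      σ′-below y y<M =
        σ′≗σ y λ y∈ → [ ∉-copy (inj₁ y<M) , ∉-copy (inj₁ (<-≤-trans y<M (m≤m+n M N))) ]′ (∈-++⁻ _ y∈)

      load≗ : load M σ′ ≗ σ′
      load≗ y = [ (λ y<N → trans (load-below M σ′ y<N) (trans (store-copy M σ _ y<N)
                                 (sym (σ′-below y (<N⇒<M y<N)))))
                , load-above M σ′ ]′ (below-or-above y)

      σ′⊨p : σ′ ⊨ p
      σ′⊨p = ⊨-cong p (λ y∈ → sym (σ′-below _ (All.lookup (<-beyond (free p ++ free q)) (∈-++⁺ˡ y∈)))) σ⊨p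

      entry-σ′ : ∀ i → i < N → entry σ′ i ≡ entry σ i
      entry-σ′ i i<N =
        trans (cong (λ ds → (σ′ [ ū ↦ ds ]) i)
                    (evalTs-cong [] t̄ λ y∈ → σ′-below _ (<N⇒<M (All.lookup bt̄ y∈))))
              (upd-cong ū (⟦ t̄ ⟧ σ) (λ _ → σ′-below i (<N⇒<M i<N)))

      σ′⊨pre′ : σ′ ⊨ pre′
      σ′⊨pre′ = from (⊨pre′ σ′) λ i i<N → begin
        entry σ′ i          ≡⟨ entry-σ′ i i<N ⟩
        entry σ i           ≡⟨ sym (store-copy (M + N) (entry σ) σ i<N) ⟩
        store (M + N) (entry σ) σ (M + N + i)  ≡⟨ sym (store-other M σ _ (inj₂ (m≤m+n (M + N) i))) ⟩
        σ′ (M + N + i)      ≡⟨ sym (upd-∉ σ′ ū (⟦ t̄ ⟧ σ′) (∉-above bū (N≤M+N+ i))) ⟩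
        entry σ′ (M + N + i) ∎

      σ′⊨p∧pre′[w̄] : σ′ ⊨ (p ∧' pre′) [ x̄ ≔ V.map fv w̄ ]
      σ′⊨p∧pre′[w̄] = from (⊨-load M σ′ (p ∧' pre′)) (⊨-≗ (p ∧' pre′) (λ y → sym (load≗ y)) (σ′⊨p , σ′⊨pre′))

      σ′⊨ū≐w̄ : σ′ ⊨ equate (toList ū) (M +_)
      σ′⊨ū≐w̄ = from (⊨-equate (toList ū) (M +_)) (All.tabulate λ {x} x∈ →
        let x<N = All.lookup bū x∈ in trans (σ′-below x (<N⇒<M x<N)) (sym (store-copy M σ _ x<N)))

    back : ∀ τ → τ ⊨ π ∧' post′ → τ ⊨ q
    back τ ((τ⊨p∧pre′[w̄] , τ⊨ū≐w̄) , τ⊨post′) =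
      ⊨-≗ q τ*≗τ (⊨pq σ* τ* σ*⊨p (e-call d∈ (e-block (e-seq e-assign e))))
      where
      σ* : State I
      σ* = load M τ

      σ*⊨p∧pre′ : σ* ⊨ p ∧' pre′
      σ*⊨p∧pre′ = to (⊨-load M τ (p ∧' pre′)) τ⊨p∧pre′[w̄]

      σ*⊨p : σ* ⊨ p
      σ*⊨p = proj₁ σ*⊨p∧pre′

      entry-saved : ∀ i → i < N → entry σ* i ≡ store N (τ ∘ (M + N +_)) τ (N + i)
      entry-saved i i<N = begin
        entry σ* i              ≡⟨ to (⊨pre′ σ*) (proj₂ σ*⊨p∧pre′) i i<N ⟩
        entry σ* (M + N + i)    ≡⟨ upd-∉ σ* ū (⟦ t̄ ⟧ σ*) (∉-above bū (N≤M+N+ i)) ⟩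
        σ* (M + N + i)          ≡⟨ load-above M τ (N≤M+N+ i) ⟩
        τ (M + N + i)           ≡⟨ sym (store-copy N (τ ∘ (M + N +_)) τ i<N) ⟩
        store N (τ ∘ (M + N +_)) τ (N + i) ∎

      body-run : Σ (State I) λ ρ → ⟨ B , entry σ* ⟩⇓ ρ ×
                   (∀ y → y < N → y ∉ toList ū → ρ y ≡ store N (τ ∘ (M + N +_)) τ y)
      body-run = spec-post-sound d∈ (to (⊨-move N (M + N) τ (spec-post d)) τ⊨post′) (entry σ*) entry-saved

      ρ : State I
      ρ = proj₁ body-run

      e : ⟨ B , entry σ* ⟩⇓ ρ
      e = proj₁ (proj₂ body-run)

      τ* : State I
      τ* = ρ [ ū ↦ V.map σ* ū ]

      params-restored : ∀ {y} → y ∈ toList ū → τ* y ≡ τ y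
      params-restored y∈ū = trans (upd-∈ ρ σ* ū y∈ū) (trans (load-below M τ (All.lookup bū y∈ū))
                                  (sym (All.lookup (to (⊨-equate (toList ū) (M +_)) τ⊨ū≐w̄) y∈ū)))

      others-unchanged : ∀ {y} → y ∉ toList ū → τ* y ≡ τ y
      others-unchanged {y} y∉ū = trans (upd-∉ ρ ū (V.map σ* ū) y∉ū)
        ([ (λ y<N → trans (proj₂ (proj₂ body-run) y y<N y∉ū) (store-other N _ τ (inj₁ y<N)))
         , (λ N≤y → trans (frame (All.++⁻ʳ (toList ū) (decl-below d∈)) e y N≤y)
                    (trans (upd-∉ σ* ū (⟦ t̄ ⟧ σ*) y∉ū) (load-above M τ N≤y))) ]′ (below-or-above y))

      τ*≗τ : τ* ≗ τ
      τ*≗τ y = [ params-restored , others-unchanged ]′ (Dec.toSum (y ∈? toList ū))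

    private
      bcall : Below (varS (callOf d))
      bcall = subst Below (sym (fvTs-map-fv ū)) bū

      bchange : Below (changeP D (call P k t̄))
      bchange = change-below (call P k t̄) bt̄

      ȳ-≥N : All (N ≤_) (toList ȳ)
      ȳ-≥N = All.map (≤-trans (m≤n+m N M)) ȳ-≥

    derivation : ⊢⟪ π ∧' pre′ ⟫ call P k t̄ ⟪ π ∧' post′ ⟫
    derivation =
      invariance (proc-call d∈ (substitution z̄ ȳ (unique-copy N) (hyp spec∈) z̄#vars ȳ#change) ū#post′) π#change
      where
      spec∈ : ⟪ x̄≐z̄ ⟫ callOf d ⟪ spec-post d ⟫ ∈ specs D spec-pre spec-post
      spec∈ = ∈-map⁺ (λ d → ⟪ spec-pre d ⟫ callOf d ⟪ spec-post d ⟫) d∈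

      z̄#vars : Disjoint (toList z̄) (varP D (callOf d))
      z̄#vars = separated⇒Disjoint N (shift-≥ N x̄) (varP-below (callOf d) bcall)

      ȳ#change : Disjoint (toList ȳ) (changeP D (callOf d))
      ȳ#change = separated⇒Disjoint N ȳ-≥N (change-below (callOf d) bcall)

      ū#post′ : Disjoint (toList ū) (free post′)
      ū#post′ = All∉⇒Disjoint (free-substF z̄ (V.map fv ȳ) ȳ∉ū (spec-post d)
                  (λ y∈ _ → All.lookup (free-∃s (toList ū) (call-sp d) (λ _ y∉ū → y∉ū)) y∈))
        where
        ȳ∉ū : All (_∉ toList ū) (fvTs (V.map fv ȳ))
        ȳ∉ū = subst (All (_∉ toList ū)) (sym (fvTs-map-fv ȳ)) (All.map (∉-above bū) ȳ-≥N)

      π#change : Disjoint (free π) (changeP D (call P k t̄))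
      π#change = Disjoint.sym (All∉⇒Disjoint (All.++⁺
        (free-substF x̄ (V.map fv w̄) w̄∉change (p ∧' pre′) (λ _ y∉x̄ → ∉-above bchange (∉x̄⇒≥ y∉x̄)))
        (free-equate (toList ū) (M +_) (All.tabulate λ u∈ u∈c → All.lookup (change-call {ts = t̄} d∈) u∈c u∈)
                                       (All.tabulate λ {u} _ → ∉-above bchange (N≤M+ u)))))
        where
        w̄∉change : All (_∉ changeP D (call P k t̄)) (fvTs (V.map fv w̄))
        w̄∉change = subst (All (_∉ changeP D (call P k t̄))) (sym (fvTs-map-fv w̄))
                         (All.map (λ M≤y → ∉-above bchange (≤-trans N≤M M≤y)) (shift-≥ M x̄))

    w̄ȳ#vars : Disjoint (toList w̄ ++ toList ȳ) (varP D (call P k t̄) ++ free q)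
    w̄ȳ#vars = separated⇒Disjoint M (All.++⁺ (shift-≥ M x̄) (All.map (≤-trans (m≤m+n M N)) ȳ-≥))
      (All.++⁺ (All.map <N⇒<M (varP-below (call P k t̄) bt̄))
               (All.++⁻ʳ (free p) (<-beyond (free p ++ free q))))

  complete-call : ∀ {P k ts} → Below (fvTs ts) → Declared (P , k) → Complete (call P k ts)
  complete-call {ts = t̄} bt̄ (decl P k ū u B , d∈ , refl , refl) p q ⊨pq =
    consequence {q₁ = q} fwd (∃-intro (toList w̄ ++ toList ȳ) (consequence (λ _ → id) derivation back) w̄ȳ#vars)
                (λ _ → id)
    where open Call d∈ t̄ bt̄ p q ⊨pq

  complete : ∀ S → Below (varS S) → CallsDeclared S → Complete S
  complete skip                _  _        = complete-skip
  complete (assign k xs u ts)  _  _        = complete-assign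
  complete (call P k ts)       bS (c ∷ []) = complete-call bS c
  complete (S₁ ⨟ S₂)           bS cS       =
    complete-⨟ c₁ (complete S₁ (All.++⁻ˡ (varS S₁) bS) c₁)
                  (complete S₂ (All.++⁻ʳ (varS S₁) bS) (All.++⁻ʳ (callsS S₁) cS))
    where
    c₁ : CallsDeclared S₁
    c₁ = All.++⁻ˡ (callsS S₁) cS
  complete (ifte B S₁ S₂)      bS cS       =
    complete-if (complete S₁ (All.++⁻ˡ (varS S₁) b₁₂) (All.++⁻ˡ (callsS S₁) cS))
                (complete S₂ (All.++⁻ʳ (varS S₁) b₁₂) (All.++⁻ʳ (callsS S₁) cS))
    where
    b₁₂ : Below (varS S₁ ++ varS S₂)
    b₁₂ = All.++⁻ʳ (free (BExp.form B)) bS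
  complete (while B S)         bS cS       =
    complete-while bS cS (complete S (All.++⁻ʳ (free (BExp.form B)) bS) cS)
  complete (block k xs u ts S) bS cS       =
    complete-block bS (complete S (All.++⁻ʳ (fvTs ts) (All.++⁻ʳ (toList xs) bS)) cS)

  completeness : ∀ {p q} → ⊨⟪ p ⟫ S₀ ⟪ q ⟫ → Provable I D p S₀ q
  completeness ⊨pq = recursion spec-pre spec-post
    (complete S₀ (All.++⁻ˡ (varS S₀) program-below) (All.++⁻ˡ (callsS S₀) (proj₂ wf)) _ _ ⊨pq)
    (λ d d∈ → complete (body d) (All.++⁻ʳ (toList (params d)) (decl-below d∈)) (body-declared d∈) _ _
                        (spec-body-valid d∈))
    (λ d d∈ → All∉⇒Disjoint (free-∃s (toList (params d)) (call-sp d) (λ _ y∉ → y∉)))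

theorem2 : (L : Signature) → let open Lang L in
    (I : Interp) → Expressive I →
    (D : List Decl) (S : Stmt) (p q : Assertion) →
    WFProg D S → Valid I D p S q → Provable I D p S q
theorem2 L I expressive D S p q wf ⊨pq =
  Completeness.completeness L I expressive D S wf (fresh (Lang.varP L D S)) (<-fresh (Lang.varP L D S)) ⊨pq
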